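{- Let $q$ be a prime power, $1\le\ell\le m-1$, $V_m$ an $m$-dimensional $\mathbb{F}_q$-vector space with ordered basis $\mathcal{B}=\{v_1,\dots,v_m\}$, and $\alpha\in I(\ell,m)$ with $\alpha_\ell=m$ and $\alpha_1,\dots,\alpha_\ell$ not consecutive integers; let $k$, $\alpha'$ and $\mathfrak{S}_\alpha(\ell,V_m,\mathcal{B})$ be as defined below. Then $$|\mathfrak{S}_\alpha(\ell,V_m,\mathcal{B})|=\frac{q^{m-\alpha_k}-1}{q-1},$$ and for every $L\in\Omega_\alpha(\ell,V_m,\mathcal{B})$, $$\left|\{\Omega\in\mathfrak{S}_\alpha(\ell,V_m,\mathcal{B}): L\in\Omega\}\right|\ge\frac{q^{(m-\alpha_k)-(\ell-k)}-1}{q-1}.$$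
   Context: $V_i=\mathrm{span}\{v_1,\dots,v_i\}$. $I(\ell,n)$ is the set of integer tuples $1\le\gamma_1<\dots<\gamma_\ell\le n$. $\Omega_\alpha(\ell,V_m,\mathcal{B})=\{L\subseteq V_m:\dim L=\ell,\ \dim(L\cap V_{\alpha_j})\ge j\ \forall j\}$. $k=\max\{j:\alpha_{j+1}-\alpha_j\ge2\}$; $\alpha'\in I(\ell,m-1)$ with $\alpha'_i=\alpha_i$ for $i\le k$, $\alpha'_i=\alpha_i-1$ for $i>k$. For an $(m-1)$-dimensional subspace $W_{m-1}\subseteq V_m$ with ordered basis $\mathcal{B}_1=\{w_1,\dots,w_{m-1}\}$, $W_i=\mathrm{span}\{w_1,\dots,w_i\}$, define $\Omega_{\alpha'}(\ell,W_{m-1},\mathcal{B}_1)=\{L\subseteq W_{m-1}:\dim L=\ell,\ \dim(L\cap W_{\alpha'_j})\ge j\ \forall j\}$. This is said to be strictly contained in $\Omega_\alpha(\ell,V_m,\mathcal{B})$ if $W_{\alpha_i}=V_{\alpha_i}$ for $i=1,\dots,k$ and $V_{\alpha_k}\subseteq W_{m-1}\subseteq V_m$. $\mathfrak{S}_\alpha(\ell,V_m,\mathcal{B})$ is the set of all such subsets $\Omega_{\alpha'}(\ell,W_{m-1},\mathcal{B}_1)$ (as subsets of the set of $\ell$-dimensional subspaces of $V_m$) strictly contained in $\Omega_\alpha(\ell,V_m,\mathcal{B})$. -}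

module Defs where

open import Level using (Level; 0ℓ; _⊔_) renaming (suc to lsuc)
open import Algebra.Bundles using (CommutativeRing)
open import Data.Nat using (ℕ; zero; suc; _+_; _∸_; _≤_; _<_; _^_)
open import Data.Nat.Primality using (Prime)
open import Data.Fin using (Fin; toℕ) renaming (zero to fzero; suc to fsuc)
open import Data.Product using (Σ; ∃; _×_; _,_)
open import Data.Unit using (⊤)
open import Data.Bool using (true; false)
open import Data.Nat using (_≤ᵇ_)
open import Relation.Nullary using (¬_)
open import Relation.Binary.PropositionalEquality using (_≡_)

HasCard : ∀ {a r p} {A : Set a} (_≈_ : A → A → Set r) → (A → Set p) → ℕ → Set (a ⊔ r ⊔ p)
HasCard {A = A} _≈_ P n =
  Σ (Fin n → A) λ f →
    (∀ i → P (f i)) ×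
    (∀ i j → f i ≈ f j → i ≡ j) ×
    (∀ x → P x → ∃ λ i → x ≈ f i)

AtLeast : ∀ {a r p} {A : Set a} (_≈_ : A → A → Set r) → (A → Set p) → ℕ → Set (a ⊔ r ⊔ p)
AtLeast {A = A} _≈_ P n =
  Σ (Fin n → A) λ f →
    (∀ i → P (f i)) ×
    (∀ i j → f i ≈ f j → i ≡ j)

_⇔_ : ∀ {a b} → Set a → Set b → Set (a ⊔ b)
A ⇔ B = (A → B) × (B → A)

IsPrimePower : ℕ → Set
IsPrimePower q = Σ ℕ λ p → Σ ℕ λ e → Prime p × 1 ≤ e × q ≡ p ^ e

record Field : Set₁ where
  field
    commRing : CommutativeRing 0ℓ 0ℓ
  open CommutativeRing commRing public
  field
    0≉1     : ¬ (0# ≈ 1#)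
    inverse : ∀ x → ¬ (x ≈ 0#) → ∃ λ y → (x * y) ≈ 1#

FieldOfSize : Field → ℕ → Set
FieldOfSize F q = HasCard (Field._≈_ F) (λ _ → ⊤) q

module LinAlg (F : Field) where
  open Field F renaming (_+_ to _⊕_; _*_ to _⊛_)

  Vect : ℕ → Set
  Vect m = Fin m → Carrier

  _≋_ : ∀ {m} → Vect m → Vect m → Set
  u ≋ v = ∀ t → u t ≈ v t

  0v : ∀ {m} → Vect m
  0v _ = 0#

  _+v_ : ∀ {m} → Vect m → Vect m → Vect m
  (u +v v) t = u t ⊕ v t

  _·v_ : ∀ {m} → Carrier → Vect m → Vect m
  (c ·v u) t = c ⊛ u t

  lincomb : ∀ {n m} → (Fin n → Carrier) → (Fin n → Vect m) → Vect m
  lincomb {zero}  c u = 0v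
  lincomb {suc n} c u = (c fzero ·v u fzero) +v lincomb (λ i → c (fsuc i)) (λ i → u (fsuc i))

  LinIndep : ∀ {n m} → (Fin n → Vect m) → Set
  LinIndep u = ∀ c → lincomb c u ≋ 0v → ∀ i → c i ≈ 0#

  InSpanPrefix : ∀ {n m} → (Fin n → Vect m) → ℕ → Vect m → Set
  InSpanPrefix u a v =
    Σ (Fin _ → Carrier) λ c → (∀ i → a ≤ toℕ i → c i ≈ 0#) × (v ≋ lincomb c u)

  InSpan : ∀ {n m} → (Fin n → Vect m) → Vect m → Set
  InSpan {n} u = InSpanPrefix u n

  record Subspace (m : ℕ) : Set₁ where
    field
      mem    : Vect m → Set
      resp   : ∀ {u v} → u ≋ v → mem u → mem v
      0∈     : mem 0v
      +∈     : ∀ {u v} → mem u → mem v → mem (u +v v)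
      ·∈     : ∀ c {u} → mem u → mem (c ·v u)
  open Subspace public

  _≐_ : ∀ {m} → Subspace m → Subspace m → Set
  L ≐ M = ∀ v → mem L v ⇔ mem M v

  HasDim : ∀ {m} → Subspace m → ℕ → Set
  HasDim {m} L d =
    Σ (Fin d → Vect m) λ b →
      (∀ i → mem L (b i)) × LinIndep b × (∀ v → mem L v → InSpan b v)

  DimMeetPrefixAtLeast : ∀ {n m} → Subspace m → (Fin n → Vect m) → ℕ → ℕ → Set
  DimMeetPrefixAtLeast {m = m} L u a j =
    Σ (Fin j → Vect m) λ b →
      (∀ i → mem L (b i) × InSpanPrefix u a (b i)) × LinIndep b

  IsBasis : ∀ {m} → (Fin m → Vect m) → Set
  IsBasis v = LinIndep v × (∀ x → InSpan v x)

  -- Schubert cell Ω_α(ℓ, span u, u): ℓ-dimensional subspaces L of F^m with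
  -- L ⊆ span{u_1..u_n} and dim(L ∩ span{u_1..u_{α_j}}) ≥ j for j = 1..ℓ.
  -- (α is indexed 1-based: only α 1, ..., α ℓ are used.)
  Omega : ∀ {n m} → ℕ → (ℕ → ℕ) → (Fin n → Vect m) → Subspace m → Set
  Omega ℓ α u L =
    HasDim L ℓ × (∀ v → mem L v → InSpan u v) ×
    (∀ j → 1 ≤ j → j ≤ ℓ → DimMeetPrefixAtLeast L u (α j) j)

  Family : ℕ → Set₁
  Family m = Subspace m → Set

  _≗F_ : ∀ {m} → Family m → Family m → Set₁
  P ≗F Q = ∀ L → P L ⇔ Q L

InI : ℕ → ℕ → (ℕ → ℕ) → Set
InI ℓ n α = 1 ≤ α 1 × (∀ j → 1 ≤ j → j < ℓ → α j < α (suc j)) × α ℓ ≤ n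

Consecutive : ℕ → (ℕ → ℕ) → Set
Consecutive ℓ α = ∀ j → 1 ≤ j → j < ℓ → α (suc j) ≡ suc (α j)

IsK : ℕ → (ℕ → ℕ) → ℕ → Set
IsK ℓ α k =
  (1 ≤ k × k < ℓ × 2 + α k ≤ α (suc k)) ×
  (∀ j → 1 ≤ j → j < ℓ → 2 + α j ≤ α (suc j) → j ≤ k)

alpha' : (ℕ → ℕ) → ℕ → ℕ → ℕ
alpha' α k i with i ≤ᵇ k
... | true  = α i
... | false = α i ∸ 1

module Schubert (F : Field) where
  open Field F renaming (_+_ to _⊕_; _*_ to _⊛_)
  open LinAlg F

  -- Ω_{α'}(ℓ, W_{m-1}, B₁) is strictly contained in Ω_α(ℓ, V_m, B):
  -- W_{α_i} = V_{α_i} for i = 1..k, and V_{α_k} ⊆ W_{m-1} (⊆ V_m holds trivially).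
  StrictlyContained : ∀ {m} → (B : Fin m → Vect m) → (ℕ → ℕ) → ℕ →
                      (B₁ : Fin (m ∸ 1) → Vect m) → Set
  StrictlyContained B α k B₁ =
    (∀ i → 1 ≤ i → i ≤ k → ∀ v → InSpanPrefix B₁ (α i) v ⇔ InSpanPrefix B (α i) v) ×
    (∀ v → InSpanPrefix B (α k) v → InSpan B₁ v)

  InFrakS : ∀ {m} → ℕ → (B : Fin m → Vect m) → (ℕ → ℕ) → ℕ → Family m → Set₁
  InFrakS {m} ℓ B α k Ω =
    Σ (Fin (m ∸ 1) → Vect m) λ B₁ →
      LinIndep B₁ × StrictlyContained B α k B₁ ×
      (Ω ≗F Omega ℓ (alpha' α k) B₁)

-- A hyperplane W ⊇ V_{α_k} of V_m is the kernel of a functional y that vanishes on v_1, …, v_{α_k}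
-- and is unique once normalized to have leading coefficient 1, at some position p ≥ α_k; then
-- B₁ = (v_t − y_t v_p)_{t ≠ p} is a basis of W whose first α_i vectors span V_{α_i} for i ≤ k.
-- Since α_{k+1}, …, α_ℓ = m are consecutive, α′_j = (m − 1) − (ℓ − j) for j > k, and these Schubert
-- conditions hold for every ℓ-subspace of W. So Ω_{α′}(ℓ, W, B₁) depends only on W, and distinct W
-- give distinct families because every vector of B₁ lies in some member. Hence 𝔖 is in bijection
-- with the normalized functionals on coordinates α_k + 1, …, m, of which there are
-- (q^{m − α_k} − 1)/(q − 1).
-- For L ∈ Ω_α, dim (L ∩ V_{α_k}) ≥ k gives dim (L + V_{α_k}) ≤ α_k + ℓ − k, so the functionals
-- vanishing on L + V_{α_k} form a space of dimension at least (m − α_k) − (ℓ − k), and its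
-- normalized elements give that many distinct members of 𝔖 containing L.

module Submission where

open import Defs
open import Data.Nat as ℕ using (ℕ; zero; suc; z≤n; s≤s; _∸_; _≤_; _<_; _^_; NonZero)
import Data.Nat.Properties as ℕ
open import Data.Nat.DivMod using (_/_; m*n/n≡m)
open import Data.Bool using (true; false)
open import Data.Fin as Fin using (Fin; toℕ; punchIn; punchOut; _↑ˡ_; _↑ʳ_; splitAt)
  renaming (zero to fzero; suc to fsuc)
import Data.Fin.Properties as Fin
open import Data.Vec.Functional using (_∷_; _++_; tail; removeAt; insertAt)
open import Data.Vec.Functional.Properties
  using (insertAt-lookup; insertAt-punchIn; removeAt-punchOut; lookup-++ˡ; lookup-++ʳ)
open import Data.Product using (Σ; ∃; _×_; _,_; proj₁; proj₂)
open import Data.Sum using (_⊎_; inj₁; inj₂)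
open import Data.Unit using (⊤; tt)
open import Data.Empty using (⊥; ⊥-elim)
open import Function using (_∘_; id)
open import Relation.Nullary using (¬_; yes; no; ¬?)
open import Relation.Nullary.Decidable using (decidable-stable)
open import Relation.Binary.Definitions using (Decidable; Tri; tri<; tri≈; tri>)
open import Relation.Binary.PropositionalEquality as ≡ using (_≡_; _≢_)

toℕ-punchIn-< : ∀ {n} (p : Fin (suc n)) (i : Fin n) → toℕ i ℕ.< toℕ p → toℕ (punchIn p i) ≡ toℕ i
toℕ-punchIn-< (fsuc p) fzero    i<p       = ≡.refl
toℕ-punchIn-< (fsuc p) (fsuc i) (s≤s i<p) = ≡.cong suc (toℕ-punchIn-< p i i<p)

toℕ≤toℕ-punchIn : ∀ {n} (p : Fin (suc n)) (i : Fin n) → toℕ i ℕ.≤ toℕ (punchIn p i)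
toℕ≤toℕ-punchIn fzero    i        = ℕ.n≤1+n (toℕ i)
toℕ≤toℕ-punchIn (fsuc p) fzero    = z≤n
toℕ≤toℕ-punchIn (fsuc p) (fsuc i) = s≤s (toℕ≤toℕ-punchIn p i)

++-view : ∀ m {n} (i : Fin (m ℕ.+ n)) → (∃ λ i′ → i′ ↑ˡ n ≡ i) ⊎ (∃ λ j → m ↑ʳ j ≡ i)
++-view m i with splitAt m i in eq
... | inj₁ i′ = inj₁ (i′ , Fin.splitAt⁻¹-↑ˡ eq)
... | inj₂ j  = inj₂ (j , Fin.splitAt⁻¹-↑ʳ eq)

covering-subfamily : ∀ {n ℓ} → 1 ≤ ℓ → ℓ ≤ n → (i₀ : Fin n) →
  Σ (Fin ℓ → Fin n) λ ι → (∀ r r′ → ι r ≡ ι r′ → r ≡ r′) × (∃ λ r → ι r ≡ i₀) ×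
                          (∀ t → toℕ t < ℕ.pred ℓ → ∃ λ r → ι r ≡ t)
covering-subfamily {ℓ = suc l} (s≤s z≤n) ℓ≤n i₀ with toℕ i₀ ℕ.<? suc l
... | yes i₀<ℓ = ι , Fin.inject≤-injective ℓ≤n ℓ≤n , (Fin.fromℕ< i₀<ℓ , hit i₀<ℓ) ,
                 λ t t<l → Fin.fromℕ< (ℕ.m<n⇒m<1+n t<l) , hit (ℕ.m<n⇒m<1+n t<l)
  where
  ι = λ r → Fin.inject≤ r ℓ≤n
  hit : ∀ {t} (t<ℓ : toℕ t < suc l) → ι (Fin.fromℕ< t<ℓ) ≡ t
  hit t<ℓ = Fin.toℕ-injective (≡.trans (Fin.toℕ-inject≤ _ ℓ≤n) (Fin.toℕ-fromℕ< t<ℓ))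
... | no i₀≮ℓ = ι , ι-injective , (fzero , ≡.refl) , λ t t<l → fsuc (Fin.fromℕ< t<l) , hit t<l
  where
  l≤n = ℕ.≤-trans (ℕ.n≤1+n l) ℓ≤n
  ι = i₀ ∷ λ r → Fin.inject≤ r l≤n
  hit : ∀ {t} (t<l : toℕ t < l) → Fin.inject≤ (Fin.fromℕ< t<l) l≤n ≡ t
  hit t<l = Fin.toℕ-injective (≡.trans (Fin.toℕ-inject≤ _ l≤n) (Fin.toℕ-fromℕ< t<l))
  i₀-below : ∀ r → i₀ ≡ Fin.inject≤ r l≤n → toℕ i₀ < suc l
  i₀-below r i₀≡r = ≡.subst (_< suc l) (≡.sym (≡.trans (≡.cong toℕ i₀≡r) (Fin.toℕ-inject≤ r l≤n)))
                      (ℕ.m<n⇒m<1+n (Fin.toℕ<n r))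
  ι-injective : ∀ r r′ → ι r ≡ ι r′ → r ≡ r′
  ι-injective fzero    fzero     _   = ≡.refl
  ι-injective fzero    (fsuc r′) eq  = ⊥-elim (i₀≮ℓ (i₀-below r′ eq))
  ι-injective (fsuc r) fzero     eq  = ⊥-elim (i₀≮ℓ (i₀-below r (≡.sym eq)))
  ι-injective (fsuc r) (fsuc r′) eq  = ≡.cong fsuc (Fin.inject≤-injective l≤n l≤n r r′ eq)

module _ {a b r s p t} {A : Set a} {B : Set b} {_≈A_ : A → A → Set r} {_≈B_ : B → B → Set s}
         {P : A → Set p} {Q : B → Set t} (g : A → B)
         (P⇒Q : ∀ {x} → P x → Q (g x)) (g-inj : ∀ {x y} → P x → P y → g x ≈B g y → x ≈A y) where

  AtLeast-map : ∀ {n} → HasCard _≈A_ P n → AtLeast _≈B_ Q n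
  AtLeast-map (f , f∈P , f-inj , _) = g ∘ f , P⇒Q ∘ f∈P , λ i j → f-inj i j ∘ g-inj (f∈P i) (f∈P j)

  HasCard-map : (∀ {z} → Q z → ∃ λ x → P x × z ≈B g x) → (∀ {x y} → P y → x ≈A y → g x ≈B g y) →
                (∀ {x y z} → x ≈B y → y ≈B z → x ≈B z) → ∀ {n} → HasCard _≈A_ P n → HasCard _≈B_ Q n
  HasCard-map g-surj g-resp ≈B-trans (f , f∈P , f-inj , f-surj) =
    g ∘ f , P⇒Q ∘ f∈P , (λ i j → f-inj i j ∘ g-inj (f∈P i) (f∈P j)) , g∘f-surj
    where
    g∘f-surj : ∀ z → Q z → ∃ λ i → z ≈B g (f i)
    g∘f-surj z Qz with g-surj Qz
    ... | x , Px , z≈gx with f-surj x Px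
    ...   | i , x≈fi = i , ≈B-trans z≈gx (g-resp (f∈P i) x≈fi)

HasCard-⊎ : ∀ {a r p} {A : Set a} {_≈_ : A → A → Set r} {P Q R : A → Set p} {n₁ n₂} →
            HasCard _≈_ P n₁ → HasCard _≈_ Q n₂ →
            (∀ {x y} → x ≈ y → P x → Q y → ⊥) → (∀ {x y} → x ≈ y → Q x → P y → ⊥) →
            (∀ {x} → R x → P x ⊎ Q x) → (∀ {x} → P x → R x) → (∀ {x} → Q x → R x) →
            HasCard _≈_ R (n₁ ℕ.+ n₂)
HasCard-⊎ {_≈_ = _≈_} {P} {Q} {R} {n₁} {n₂}
          (f₁ , f₁∈P , f₁-inj , f₁-surj) (f₂ , f₂∈Q , f₂-inj , f₂-surj) P≉Q Q≉P R⇒P⊎Q P⇒R Q⇒R =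
  f₁ ++ f₂ , f∈R , f-inj , f-surj
  where
  fˡ : ∀ i → (f₁ ++ f₂) (i ↑ˡ n₂) ≡ f₁ i
  fˡ = lookup-++ˡ f₁ f₂
  fʳ : ∀ j → (f₁ ++ f₂) (n₁ ↑ʳ j) ≡ f₂ j
  fʳ = lookup-++ʳ f₁ f₂
  f∈R : ∀ i → R ((f₁ ++ f₂) i)
  f∈R i with ++-view n₁ i
  ... | inj₁ (i′ , ≡.refl) = ≡.subst R (≡.sym (fˡ i′)) (P⇒R (f₁∈P i′))
  ... | inj₂ (j  , ≡.refl) = ≡.subst R (≡.sym (fʳ j)) (Q⇒R (f₂∈Q j))
  f-inj : ∀ i j → (f₁ ++ f₂) i ≈ (f₁ ++ f₂) j → i ≡ j
  f-inj i j fi≈fj with ++-view n₁ i | ++-view n₁ j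
  ... | inj₁ (i′ , ≡.refl) | inj₁ (j′ , ≡.refl) =
    ≡.cong (_↑ˡ n₂) (f₁-inj i′ j′ (≡.subst₂ _≈_ (fˡ i′) (fˡ j′) fi≈fj))
  ... | inj₂ (i′ , ≡.refl) | inj₂ (j′ , ≡.refl) =
    ≡.cong (n₁ ↑ʳ_) (f₂-inj i′ j′ (≡.subst₂ _≈_ (fʳ i′) (fʳ j′) fi≈fj))
  ... | inj₁ (i′ , ≡.refl) | inj₂ (j′ , ≡.refl) =
    ⊥-elim (P≉Q (≡.subst₂ _≈_ (fˡ i′) (fʳ j′) fi≈fj) (f₁∈P i′) (f₂∈Q j′))
  ... | inj₂ (i′ , ≡.refl) | inj₁ (j′ , ≡.refl) =
    ⊥-elim (Q≉P (≡.subst₂ _≈_ (fʳ i′) (fˡ j′) fi≈fj) (f₂∈Q i′) (f₁∈P j′))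
  f-surj : ∀ x → R x → ∃ λ i → x ≈ (f₁ ++ f₂) i
  f-surj x Rx with R⇒P⊎Q Rx
  ... | inj₁ Px with f₁-surj x Px
  ...   | i , x≈f₁i = i ↑ˡ n₂ , ≡.subst (x ≈_) (≡.sym (fˡ i)) x≈f₁i
  f-surj x Rx | inj₂ Qx with f₂-surj x Qx
  ...   | j , x≈f₂j = n₁ ↑ʳ j , ≡.subst (x ≈_) (≡.sym (fʳ j)) x≈f₂j

geometric : ℕ → ℕ → ℕ
geometric q zero    = 0
geometric q (suc r) = q ^ r ℕ.+ geometric q r

geometric-closed : ∀ q′ r .{{_ : NonZero q′}} → (suc q′ ^ r ∸ 1) / q′ ≡ geometric (suc q′) r
geometric-closed q′ r = ≡.trans (≡.cong (_/ q′) (≡.sym (geometric-* r))) (m*n/n≡m (geometric (suc q′) r) q′)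
  where
  open ≡.≡-Reasoning
  geometric-* : ∀ r → geometric (suc q′) r ℕ.* q′ ≡ suc q′ ^ r ∸ 1
  geometric-* zero    = ≡.refl
  geometric-* (suc r) = begin
    (t ℕ.+ geometric (suc q′) r) ℕ.* q′     ≡⟨ ℕ.*-distribʳ-+ q′ t _ ⟩
    t ℕ.* q′ ℕ.+ geometric (suc q′) r ℕ.* q′ ≡⟨ ≡.cong (t ℕ.* q′ ℕ.+_) (geometric-* r) ⟩
    t ℕ.* q′ ℕ.+ (t ∸ 1)                    ≡⟨ ℕ.+-comm (t ℕ.* q′) (t ∸ 1) ⟩
    (t ∸ 1) ℕ.+ t ℕ.* q′                    ≡⟨ ≡.cong ((t ∸ 1) ℕ.+_) (ℕ.*-comm t q′) ⟩
    (t ∸ 1) ℕ.+ q′ ℕ.* t                    ≡⟨ ℕ.+-∸-comm (q′ ℕ.* t) (ℕ.m^n>0 (suc q′) r) ⟨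
    (t ℕ.+ q′ ℕ.* t) ∸ 1                    ∎
    where t = suc q′ ^ r


module Linear (F : Field) (_≟_ : Decidable (Field._≈_ F)) where
  open Field F
  open LinAlg F
  open import Algebra.Properties.Ring ring using (-1*x≈-x; -‿distribˡ-*; -‿involutive; -0#≈0#)
  open import Algebra.Properties.Group +-group using (x∙y⁻¹≈ε⇒x≈y)
  open import Algebra.Properties.Semiring.Sum semiring
    using (sum; sum-cong-≋; sum-replicate-zero; sum-remove; ∑-distrib-+; ∑-comm; *-distribˡ-sum; *-distribʳ-sum)
  open import Data.Vec.Functional.Relation.Binary.Equality.Setoid setoid using (≋-refl; ≋-sym; ≋-trans)
  open import Algebra.Properties.CommutativeSemigroup *-commutativeSemigroup using (x∙yz≈y∙xz)
  open import Relation.Binary.Reasoning.Setoid setoid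

  1≉0 : ¬ 1# ≈ 0#
  1≉0 = 0≉1 ∘ sym

  inv : ∀ x → ¬ x ≈ 0# → Carrier
  inv x x≉0 = proj₁ (inverse x x≉0)

  *-inverseʳ : ∀ x (x≉0 : ¬ x ≈ 0#) → x * inv x x≉0 ≈ 1#
  *-inverseʳ x x≉0 = proj₂ (inverse x x≉0)

  *-inverseˡ : ∀ x (x≉0 : ¬ x ≈ 0#) → inv x x≉0 * x ≈ 1#
  *-inverseˡ x x≉0 = trans (*-comm _ x) (*-inverseʳ x x≉0)

  sum-zero : ∀ {n} {f : Fin n → Carrier} → (∀ i → f i ≈ 0#) → sum f ≈ 0#
  sum-zero {n} f≈0 = trans (sum-cong-≋ f≈0) (sum-replicate-zero n)

  unit : ∀ {n} → Fin n → Vect n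
  unit i j with i Fin.≟ j
  ... | yes _ = 1#
  ... | no _  = 0#

  unit-diag : ∀ {n} (i : Fin n) → unit i i ≈ 1#
  unit-diag i with i Fin.≟ i
  ... | yes _  = refl
  ... | no i≢i = ⊥-elim (i≢i ≡.refl)

  unit-off : ∀ {n} {i j : Fin n} → i ≢ j → unit i j ≈ 0#
  unit-off {i = i} {j} i≢j with i Fin.≟ j
  ... | yes i≡j = ⊥-elim (i≢j i≡j)
  ... | no _    = refl

  unit-∘-injective : ∀ {k n} (ι : Fin k → Fin n) → (∀ i j → ι i ≡ ι j → i ≡ j) →
                     ∀ i j → unit (ι i) (ι j) ≈ unit i j
  unit-∘-injective ι ι-inj i j with i Fin.≟ j
  ... | yes ≡.refl = unit-diag (ι i)
  ... | no i≢j     = unit-off (i≢j ∘ ι-inj i j)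

  sum-unitˡ : ∀ {n} (i : Fin n) (g : Fin n → Carrier) → sum (λ j → unit i j * g j) ≈ g i
  sum-unitˡ {suc n} i g = begin
    sum (λ j → unit i j * g j)
      ≈⟨ sum-remove {i = i} (λ j → unit i j * g j) ⟩
    unit i i * g i + sum (λ j → unit i (punchIn i j) * g (punchIn i j))
      ≈⟨ +-cong (*-cong (unit-diag i) refl) (sum-zero (λ j → zero-at j)) ⟩
    1# * g i + 0#
      ≈⟨ trans (+-identityʳ _) (*-identityˡ _) ⟩
    g i ∎
    where
    zero-at : ∀ j → unit i (punchIn i j) * g (punchIn i j) ≈ 0#
    zero-at j = trans (*-cong (unit-off (Fin.punchInᵢ≢i i j ∘ ≡.sym)) refl) (zeroˡ _)

  sum-unitʳ : ∀ {n} (i : Fin n) (g : Fin n → Carrier) → sum (λ j → g j * unit j i) ≈ g i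
  sum-unitʳ i g = trans (sum-cong-≋ (λ j → trans (*-comm (g j) _) (*-cong (unit-sym j i) refl))) (sum-unitˡ i g)
    where
    unit-sym : ∀ {n} (i j : Fin n) → unit i j ≈ unit j i
    unit-sym i j with i Fin.≟ j
    ... | yes ≡.refl = sym (unit-diag i)
    ... | no i≢j     = sym (unit-off (i≢j ∘ ≡.sym))

  lincomb-pointwise : ∀ {n m} (c : Fin n → Carrier) (u : Fin n → Vect m) t →
                      lincomb c u t ≡ sum (λ i → c i * u i t)
  lincomb-pointwise {zero}  c u t = ≡.refl
  lincomb-pointwise {suc n} c u t =
    ≡.cong (c fzero * u fzero t +_) (lincomb-pointwise (c ∘ fsuc) (u ∘ fsuc) t)

  lincomb-cong : ∀ {n m} {c d : Fin n → Carrier} {u w : Fin n → Vect m} →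
                 (∀ i → c i ≈ d i) → (∀ i → u i ≋ w i) → lincomb c u ≋ lincomb d w
  lincomb-cong {c = c} {d} {u} {w} c≈d u≋w t = begin
    lincomb c u t            ≡⟨ lincomb-pointwise c u t ⟩
    sum (λ i → c i * u i t)  ≈⟨ sum-cong-≋ (λ i → *-cong (c≈d i) (u≋w i t)) ⟩
    sum (λ i → d i * w i t)  ≡⟨ lincomb-pointwise d w t ⟨
    lincomb d w t            ∎

  lincomb-zero : ∀ {n m} {c : Fin n → Carrier} (u : Fin n → Vect m) →
                 (∀ i → c i ≈ 0#) → lincomb c u ≋ 0v
  lincomb-zero {c = c} u c≈0 t = begin
    lincomb c u t            ≡⟨ lincomb-pointwise c u t ⟩
    sum (λ i → c i * u i t)  ≈⟨ sum-zero (λ i → trans (*-cong (c≈0 i) refl) (zeroˡ _)) ⟩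
    0#                       ∎

  lincomb-+ : ∀ {n m} (c d : Fin n → Carrier) (u : Fin n → Vect m) →
              lincomb (λ i → c i + d i) u ≋ (lincomb c u +v lincomb d u)
  lincomb-+ c d u t = begin
    lincomb (λ i → c i + d i) u t                    ≡⟨ lincomb-pointwise _ u t ⟩
    sum (λ i → (c i + d i) * u i t)                  ≈⟨ sum-cong-≋ (λ i → distribʳ (u i t) (c i) (d i)) ⟩
    sum (λ i → c i * u i t + d i * u i t)            ≈⟨ ∑-distrib-+ (λ i → c i * u i t) (λ i → d i * u i t) ⟩
    sum (λ i → c i * u i t) + sum (λ i → d i * u i t)
      ≡⟨ ≡.cong₂ _+_ (lincomb-pointwise c u t) (lincomb-pointwise d u t) ⟨
    lincomb c u t + lincomb d u t                    ∎

  lincomb-* : ∀ {n m} a (c : Fin n → Carrier) (u : Fin n → Vect m) →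
              lincomb (λ i → a * c i) u ≋ (a ·v lincomb c u)
  lincomb-* a c u t = begin
    lincomb (λ i → a * c i) u t     ≡⟨ lincomb-pointwise _ u t ⟩
    sum (λ i → (a * c i) * u i t)   ≈⟨ sum-cong-≋ (λ i → *-assoc a (c i) (u i t)) ⟩
    sum (λ i → a * (c i * u i t))   ≈⟨ *-distribˡ-sum a (λ i → c i * u i t) ⟨
    a * sum (λ i → c i * u i t)     ≡⟨ ≡.cong (a *_) (lincomb-pointwise c u t) ⟨
    a * lincomb c u t               ∎

  lincomb-unit : ∀ {n m} (i : Fin n) (u : Fin n → Vect m) → lincomb (unit i) u ≋ u i
  lincomb-unit i u t = trans (reflexive (lincomb-pointwise (unit i) u t)) (sum-unitˡ i (λ j → u j t))

  lincomb-assoc : ∀ {n k m} (z : Fin k → Carrier) (C : Fin k → Fin n → Carrier) (u : Fin n → Vect m) →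
                  lincomb z (λ j → lincomb (C j) u) ≋ lincomb (λ i → sum (λ j → z j * C j i)) u
  lincomb-assoc z C u t = begin
    lincomb z (λ j → lincomb (C j) u) t
      ≡⟨ lincomb-pointwise z _ t ⟩
    sum (λ j → z j * lincomb (C j) u t)
      ≈⟨ sum-cong-≋ (λ j → *-cong refl (reflexive (lincomb-pointwise (C j) u t))) ⟩
    sum (λ j → z j * sum (λ i → C j i * u i t))
      ≈⟨ sum-cong-≋ (λ j → *-distribˡ-sum (z j) (λ i → C j i * u i t)) ⟩
    sum (λ j → sum (λ i → z j * (C j i * u i t)))
      ≈⟨ ∑-comm (λ j i → z j * (C j i * u i t)) ⟩
    sum (λ i → sum (λ j → z j * (C j i * u i t)))
      ≈⟨ sum-cong-≋ (λ i → sum-cong-≋ (λ j → sym (*-assoc (z j) (C j i) (u i t)))) ⟩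
    sum (λ i → sum (λ j → (z j * C j i) * u i t))
      ≈⟨ sum-cong-≋ (λ i → *-distribʳ-sum (u i t) (λ j → z j * C j i)) ⟨
    sum (λ i → sum (λ j → z j * C j i) * u i t)
      ≡⟨ lincomb-pointwise _ u t ⟨
    lincomb (λ i → sum (λ j → z j * C j i)) u t ∎

  lincomb-units : ∀ {m} (c : Vect m) → lincomb c unit ≋ c
  lincomb-units c t = trans (reflexive (lincomb-pointwise c unit t)) (sum-unitʳ t c)

  sum-++ : ∀ a {b} (f : Fin (a ℕ.+ b) → Carrier) → sum f ≈ sum (f ∘ (_↑ˡ b)) + sum (f ∘ (a ↑ʳ_))
  sum-++ zero    f = sym (+-identityˡ _)
  sum-++ (suc a) f = trans (+-cong refl (sum-++ a (f ∘ fsuc))) (sym (+-assoc _ _ _))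

  lincomb-++ : ∀ {a b m} (c : Fin (a ℕ.+ b) → Carrier) (g : Fin a → Vect m) (h : Fin b → Vect m) →
               lincomb c (g ++ h) ≋ (lincomb (c ∘ (_↑ˡ b)) g +v lincomb (c ∘ (a ↑ʳ_)) h)
  lincomb-++ {a} {b} c g h t = begin
    lincomb c (g ++ h) t
      ≡⟨ lincomb-pointwise c (g ++ h) t ⟩
    sum (λ i → c i * (g ++ h) i t)
      ≈⟨ sum-++ a _ ⟩
    sum (λ i → c (i ↑ˡ b) * (g ++ h) (i ↑ˡ b) t) + sum (λ j → c (a ↑ʳ j) * (g ++ h) (a ↑ʳ j) t)
      ≈⟨ +-cong (sum-cong-≋ (λ i → reflexive (≡.cong (λ v → c (i ↑ˡ b) * v t) (lookup-++ˡ g h i))))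
                (sum-cong-≋ (λ j → reflexive (≡.cong (λ v → c (a ↑ʳ j) * v t) (lookup-++ʳ g h j)))) ⟩
    sum (λ i → c (i ↑ˡ b) * g i t) + sum (λ j → c (a ↑ʳ j) * h j t)
      ≡⟨ ≡.cong₂ _+_ (lincomb-pointwise _ g t) (lincomb-pointwise _ h t) ⟨
    lincomb (c ∘ (_↑ˡ b)) g t + lincomb (c ∘ (a ↑ʳ_)) h t ∎

  lincomb-removeAt : ∀ {n m} p (c : Fin (suc n) → Carrier) (u : Fin (suc n) → Vect m) →
                     lincomb c u ≋ ((c p ·v u p) +v lincomb (removeAt c p) (removeAt u p))
  lincomb-removeAt p c u t = begin
    lincomb c u t                                      ≡⟨ lincomb-pointwise c u t ⟩
    sum (λ i → c i * u i t)                            ≈⟨ sum-remove {i = p} (λ i → c i * u i t) ⟩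
    c p * u p t + sum (λ i → c (punchIn p i) * u (punchIn p i) t)
      ≡⟨ ≡.cong (c p * u p t +_) (lincomb-pointwise (removeAt c p) (removeAt u p) t) ⟨
    c p * u p t + lincomb (removeAt c p) (removeAt u p) t ∎

  dot : ∀ {m} → Vect m → Vect m → Carrier
  dot f v = sum (λ t → f t * v t)

  dot-comm : ∀ {m} (f v : Vect m) → dot f v ≈ dot v f
  dot-comm f v = sum-cong-≋ (λ t → *-comm (f t) (v t))

  dot-congʳ : ∀ {m} (f : Vect m) {u v : Vect m} → u ≋ v → dot f u ≈ dot f v
  dot-congʳ f u≋v = sum-cong-≋ (λ t → *-cong refl (u≋v t))

  dot-unit : ∀ {m} (f : Vect m) t → dot f (unit t) ≈ f t
  dot-unit f t = trans (dot-comm f (unit t)) (sum-unitˡ t f)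

  dot-+ : ∀ {m} (f u v : Vect m) → dot f (u +v v) ≈ dot f u + dot f v
  dot-+ f u v = begin
    sum (λ t → f t * (u t + v t))          ≈⟨ sum-cong-≋ (λ t → distribˡ (f t) (u t) (v t)) ⟩
    sum (λ t → f t * u t + f t * v t)      ≈⟨ ∑-distrib-+ (λ t → f t * u t) (λ t → f t * v t) ⟩
    dot f u + dot f v                      ∎

  dot-· : ∀ {m} (f : Vect m) c (u : Vect m) → dot f (c ·v u) ≈ c * dot f u
  dot-· f c u = begin
    sum (λ t → f t * (c * u t))            ≈⟨ sum-cong-≋ (λ t → x∙yz≈y∙xz (f t) c (u t)) ⟩
    sum (λ t → c * (f t * u t))            ≈⟨ *-distribˡ-sum c (λ t → f t * u t) ⟨
    c * dot f u                            ∎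

  dot-scaleˡ : ∀ {m} {f g : Vect m} d → (∀ t → f t ≈ d * g t) → ∀ v → dot f v ≈ d * dot g v
  dot-scaleˡ {f = f} {g} d f≈dg v = begin
    sum (λ t → f t * v t)          ≈⟨ sum-cong-≋ (λ t → trans (*-cong (f≈dg t) refl) (*-assoc d (g t) (v t))) ⟩
    sum (λ t → d * (g t * v t))    ≈⟨ *-distribˡ-sum d (λ t → g t * v t) ⟨
    d * dot g v                    ∎

  kernel : ∀ {m} → Vect m → Subspace m
  kernel f = record
    { mem  = λ v → dot f v ≈ 0#
    ; resp = λ u≋v fu≈0 → trans (dot-congʳ f (≋-sym u≋v)) fu≈0
    ; 0∈   = sum-zero (λ t → zeroʳ (f t))
    ; +∈   = λ fu≈0 fv≈0 → trans (dot-+ f _ _) (trans (+-cong fu≈0 fv≈0) (+-identityˡ 0#))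
    ; ·∈   = λ c fu≈0 → trans (dot-· f c _) (trans (*-cong refl fu≈0) (zeroʳ c))
    }

  spanned : ∀ {n m} {u : Fin n → Vect m} {v : Vect m} (c : Fin n → Carrier) → v ≋ lincomb c u → InSpan u v
  spanned c v≋cu = c , (λ i n≤i → ⊥-elim (ℕ.<⇒≱ (Fin.toℕ<n i) n≤i)) , v≋cu

  prefix⇒span : ∀ {n m a} {u : Fin n → Vect m} {v : Vect m} → InSpanPrefix u a v → InSpan u v
  prefix⇒span (c , _ , v≋cu) = spanned c v≋cu

  span : ∀ {n m} → (Fin n → Vect m) → Subspace m
  span u = record
    { mem  = InSpan u
    ; resp = λ { v≋w (c , _ , v≋cu) → spanned c (≋-trans (≋-sym v≋w) v≋cu) }
    ; 0∈   = spanned (λ _ → 0#) (≋-sym (lincomb-zero u (λ _ → refl)))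
    ; +∈   = λ { (c , _ , v≋cu) (d , _ , w≋du) →
               spanned (λ i → c i + d i) (≋-trans (λ t → +-cong (v≋cu t) (w≋du t)) (≋-sym (lincomb-+ c d u))) }
    ; ·∈   = λ { a (c , _ , v≋cu) →
               spanned (λ i → a * c i) (≋-trans (λ t → *-cong refl (v≋cu t)) (≋-sym (lincomb-* a c u))) }
    }

  generator∈span : ∀ {n m} (u : Fin n → Vect m) i → InSpan u (u i)
  generator∈span u i = spanned (unit i) (≋-sym (lincomb-unit i u))

  generator∈prefix : ∀ {n m A} (u : Fin n → Vect m) t → toℕ t ℕ.< A → InSpanPrefix u A (u t)
  generator∈prefix {A = A} u t t<A = unit t , unit≈0 , ≋-sym (lincomb-unit t u)
    where
    unit≈0 : ∀ s → A ℕ.≤ toℕ s → unit t s ≈ 0#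
    unit≈0 s A≤s = unit-off λ t≡s → ℕ.<⇒≱ t<A (≡.subst (λ x → A ℕ.≤ toℕ x) (≡.sym t≡s) A≤s)

  lincomb∈subspace : ∀ {n m} (L : Subspace m) {u : Fin n → Vect m} →
                     (∀ i → mem L (u i)) → ∀ c → mem L (lincomb c u)
  lincomb∈subspace {zero}  L u∈L c = 0∈ L
  lincomb∈subspace {suc n} L u∈L c =
    +∈ L (·∈ L (c fzero) (u∈L fzero)) (lincomb∈subspace L (u∈L ∘ fsuc) (c ∘ fsuc))

  span⊆subspace : ∀ {n m} (L : Subspace m) {u : Fin n → Vect m} →
                  (∀ i → mem L (u i)) → ∀ {v} → InSpan u v → mem L v
  span⊆subspace L u∈L (c , _ , v≋cu) = resp L (≋-sym v≋cu) (lincomb∈subspace L u∈L c)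

  ++-generators : ∀ {a b m} (L : Subspace m) {g : Fin a → Vect m} {h : Fin b → Vect m} →
                  (∀ i → mem L (g i)) → (∀ j → mem L (h j)) → ∀ x → mem L ((g ++ h) x)
  ++-generators {a} L g∈L h∈L x with splitAt a x
  ... | inj₁ i = g∈L i
  ... | inj₂ j = h∈L j

  indep-unique : ∀ {n m} {u : Fin n → Vect m} → LinIndep u → ∀ c d →
                 lincomb c u ≋ lincomb d u → ∀ i → c i ≈ d i
  indep-unique {u = u} u-indep c d cu≋du i = x∙y⁻¹≈ε⇒x≈y (c i) (d i) (u-indep (λ i → c i - d i) c-d≈0 i)
    where
    c-d≈0 : lincomb (λ i → c i - d i) u ≋ 0v
    c-d≈0 t = begin
      lincomb (λ i → c i - d i) u t
        ≈⟨ lincomb-cong (λ i → +-cong refl (sym (-1*x≈-x (d i)))) (λ _ → ≋-refl) t ⟩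
      lincomb (λ i → c i + - 1# * d i) u t   ≈⟨ lincomb-+ c (λ i → - 1# * d i) u t ⟩
      lincomb c u t + lincomb (λ i → - 1# * d i) u t
                                             ≈⟨ +-cong (cu≋du t) (lincomb-* (- 1#) d u t) ⟩
      lincomb d u t + - 1# * lincomb d u t   ≈⟨ +-cong refl (-1*x≈-x _) ⟩
      lincomb d u t - lincomb d u t          ≈⟨ -‿inverseʳ _ ⟩
      0#                                     ∎

  indep-∘ : ∀ {n k m} {w : Fin n → Vect m} → LinIndep w → (ι : Fin k → Fin n) →
            (∀ i j → ι i ≡ ι j → i ≡ j) → LinIndep (w ∘ ι)
  indep-∘ {w = w} w-indep ι ι-inj c cwι≈0 r = begin
    c r                                   ≈⟨ sum-unitʳ r c ⟨
    sum (λ s → c s * unit s r)            ≈⟨ sum-cong-≋ (λ s → *-cong refl (unit-∘-injective ι ι-inj s r)) ⟨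
    sum (λ s → c s * unit (ι s) (ι r))    ≈⟨ w-indep c′ cw≈0 (ι r) ⟩
    0#                                    ∎
    where
    c′ = λ t → sum (λ s → c s * unit (ι s) t)
    cw≈0 : lincomb c′ w ≋ 0v
    cw≈0 = ≋-trans (≋-sym (lincomb-assoc c (unit ∘ ι) w))
                   (≋-trans (lincomb-cong (λ _ → refl) (λ s → lincomb-unit (ι s) w)) cwι≈0)

  units-indep : ∀ {m} → LinIndep (unit {m})
  units-indep c c·e≈0 t = trans (sym (lincomb-units c t)) (c·e≈0 t)

  indep-lincomb : ∀ {j l m} {X : Fin j → Vect l} {b : Fin l → Vect m} → LinIndep X → LinIndep b →
                  LinIndep (λ r → lincomb (X r) b)
  indep-lincomb {X = X} {b} X-indep b-indep z zXb≈0 = X-indep z λ i →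
    trans (reflexive (lincomb-pointwise z X i)) (b-indep _ (≋-trans (≋-sym (lincomb-assoc z X b)) zXb≈0) i)

  indep⇒nonzero : ∀ {n m} {X : Fin n → Vect m} → LinIndep X → ∀ i → ¬ (∀ t → X i t ≈ 0#)
  indep⇒nonzero {X = X} X-indep i Xi≈0 =
    1≉0 (trans (sym (unit-diag i)) (X-indep (unit i) (≋-trans (lincomb-unit i X) Xi≈0) i))

  indep-head∉span-tail : ∀ {k m} {g : Fin (suc k) → Vect m} → LinIndep g →
                         ∀ μ → ¬ (g fzero ≋ lincomb μ (tail g))
  indep-head∉span-tail {g = g} g-indep μ g₀≋μg′ = 1≉0 (begin
    1#          ≈⟨ -‿involutive 1# ⟨
    - (- 1#)    ≈⟨ -‿cong (g-indep (- 1# ∷ μ) combination≈0 fzero) ⟩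
    - 0#        ≈⟨ -0#≈0# ⟩
    0#          ∎)
    where
    combination≈0 : lincomb (- 1# ∷ μ) g ≋ 0v
    combination≈0 t = begin
      - 1# * g fzero t + lincomb μ (tail g) t   ≈⟨ +-cong (trans (-1*x≈-x _) (-‿cong (g₀≋μg′ t))) refl ⟩
      - lincomb μ (tail g) t + lincomb μ (tail g) t ≈⟨ -‿inverseˡ _ ⟩
      0#                                        ∎

  shear : ∀ {n m} → Fin (suc n) → (Fin n → Carrier) → (Fin (suc n) → Vect m) → Fin n → Vect m
  shear p κ G i = G (punchIn p i) +v (κ i ·v G p)

  lincomb-shear : ∀ {n m} p (κ z : Fin n → Carrier) (G : Fin (suc n) → Vect m) →
                  lincomb z (shear p κ G) ≋ lincomb (insertAt z p (sum (λ i → z i * κ i))) G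
  lincomb-shear p κ z G t = begin
    lincomb z (shear p κ G) t
      ≡⟨ lincomb-pointwise z (shear p κ G) t ⟩
    sum (λ i → z i * (G (punchIn p i) t + κ i * G p t))
      ≈⟨ sum-cong-≋ (λ i → trans (distribˡ (z i) _ _) (+-cong refl (sym (*-assoc (z i) (κ i) (G p t))))) ⟩
    sum (λ i → z i * G (punchIn p i) t + z i * κ i * G p t)
      ≈⟨ ∑-distrib-+ (λ i → z i * G (punchIn p i) t) (λ i → z i * κ i * G p t) ⟩
    sum (λ i → z i * G (punchIn p i) t) + sum (λ i → z i * κ i * G p t)
      ≈⟨ +-cong refl (*-distribʳ-sum (G p t) (λ i → z i * κ i)) ⟨
    sum (λ i → z i * G (punchIn p i) t) + S * G p t
      ≈⟨ +-comm _ _ ⟩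
    S * G p t + sum (λ i → z i * G (punchIn p i) t)
      ≈⟨ +-cong (*-cong (reflexive (≡.sym (insertAt-lookup z p S))) refl)
                (sum-cong-≋ (λ i → *-cong (reflexive (≡.sym (insertAt-punchIn z p S i))) refl)) ⟩
    c p * G p t + sum (λ i → c (punchIn p i) * G (punchIn p i) t)
      ≈⟨ sum-remove {i = p} (λ j → c j * G j t) ⟨
    sum (λ j → c j * G j t)
      ≡⟨ lincomb-pointwise c G t ⟨
    lincomb c G t ∎
    where
    S = sum (λ i → z i * κ i)
    c = insertAt z p S

  insertAt-removeAt-≈ : ∀ {n} (c : Fin (suc n) → Carrier) p {x} → x ≈ c p →
                        ∀ t → insertAt (removeAt c p) p x t ≈ c t
  insertAt-removeAt-≈ c p {x} x≈cp t with p Fin.≟ t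
  ... | yes ≡.refl = trans (reflexive (insertAt-lookup (removeAt c p) p x)) x≈cp
  ... | no p≢t     = begin
    insertAt (removeAt c p) p x t                 ≡⟨ ≡.cong (insertAt (removeAt c p) p x) (Fin.punchIn-punchOut p≢t) ⟨
    insertAt (removeAt c p) p x (punchIn p _)     ≡⟨ insertAt-punchIn (removeAt c p) p x _ ⟩
    removeAt c p (punchOut p≢t)                   ≡⟨ removeAt-punchOut c p≢t ⟩
    c t                                           ∎

  shear-indep : ∀ {n m} {G : Fin (suc n) → Vect m} → LinIndep G → ∀ p κ → LinIndep (shear p κ G)
  shear-indep {G = G} G-indep p κ z zX≈0 i = begin
    z i                              ≡⟨ insertAt-punchIn z p S i ⟨
    insertAt z p S (punchIn p i)
      ≈⟨ G-indep (insertAt z p S) (≋-trans (≋-sym (lincomb-shear p κ z G)) zX≈0) (punchIn p i) ⟩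
    0#                               ∎
    where S = sum (λ i → z i * κ i)

  shear∈span : ∀ {n m} p κ (G : Fin (suc n) → Vect m) i → InSpan G (shear p κ G i)
  shear∈span p κ G i = +∈ (span G) (generator∈span G (punchIn p i)) (·∈ (span G) (κ i) (generator∈span G p))

  ZeroBelow : ∀ {N} → ℕ → Vect N → Set
  ZeroBelow A y = ∀ t → toℕ t ℕ.< A → y t ≈ 0#

  first-nonzero : ∀ {n} (v : Vect n) → ¬ (∀ t → v t ≈ 0#) →
                  Σ (Fin n) λ p → ¬ v p ≈ 0# × ZeroBelow (toℕ p) v
  first-nonzero v v≉0 with Fin.¬∀⟶∃¬-smallest _ (λ t → v t ≈ 0#) (λ t → v t ≟ 0#) v≉0
  ... | p , vp≉0 , below =
    p , vp≉0 , λ t t<p → ≡.subst (λ s → v s ≈ 0#) (inject-fromℕ< t<p) (below (Fin.fromℕ< t<p))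
    where
    inject-fromℕ< : ∀ {t} (t<p : toℕ t ℕ.< toℕ p) → Fin.inject (Fin.fromℕ< t<p) ≡ t
    inject-fromℕ< t<p = Fin.toℕ-injective (≡.trans (Fin.toℕ-inject _) (Fin.toℕ-fromℕ< t<p))

  LeadingOne : ∀ {N} → Fin N → Vect N → Set
  LeadingOne p y = y p ≈ 1# × ZeroBelow (toℕ p) y

  leadingOne-unique : ∀ {N} {p p′ : Fin N} {y y′ : Vect N} c → LeadingOne p y → LeadingOne p′ y′ →
                      (∀ t → y t ≈ c * y′ t) → p ≡ p′ × y ≋ y′
  leadingOne-unique {p = p} {p′} {y} {y′} c (yp≈1 , y<p≈0) (y′p′≈1 , y′<p′≈0) y≈cy′ =
    compare (ℕ.<-cmp (toℕ p) (toℕ p′))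
    where
    c≈yp′ : c ≈ y p′
    c≈yp′ = begin
      c          ≈⟨ *-identityʳ c ⟨
      c * 1#     ≈⟨ *-cong refl y′p′≈1 ⟨
      c * y′ p′  ≈⟨ y≈cy′ p′ ⟨
      y p′       ∎
    compare : Tri (toℕ p ℕ.< toℕ p′) (toℕ p ≡ toℕ p′) (toℕ p′ ℕ.< toℕ p) → p ≡ p′ × y ≋ y′
    compare (tri< p<p′ _ _) = ⊥-elim (1≉0 (begin
      1#         ≈⟨ yp≈1 ⟨
      y p        ≈⟨ y≈cy′ p ⟩
      c * y′ p   ≈⟨ *-cong refl (y′<p′≈0 p p<p′) ⟩
      c * 0#     ≈⟨ zeroʳ c ⟩
      0#         ∎))
    compare (tri> _ _ p′<p) = ⊥-elim (1≉0 (begin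
      1#         ≈⟨ yp≈1 ⟨
      y p        ≈⟨ y≈cy′ p ⟩
      c * y′ p   ≈⟨ *-cong (trans c≈yp′ (y<p≈0 p′ p′<p)) refl ⟩
      0# * y′ p  ≈⟨ zeroˡ _ ⟩
      0#         ∎))
    compare (tri≈ _ toℕp≡toℕp′ _) = p≡p′ , λ t → trans (y≈cy′ t) (trans (*-cong c≈1 refl) (*-identityˡ (y′ t)))
      where
      p≡p′ = Fin.toℕ-injective toℕp≡toℕp′
      c≈1 : c ≈ 1#
      c≈1 = trans c≈yp′ (≡.subst (λ s → y s ≈ 1#) p≡p′ yp≈1)

  record Normalizes {N} (v : Vect N) (x : Fin N × Vect N) : Set where
    field
      leading : LeadingOne (proj₁ x) (proj₂ x)
      c       : Carrier
      v≈c*y   : ∀ t → v t ≈ c * proj₂ x t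
      d       : Carrier
      y≈d*v   : ∀ t → proj₂ x t ≈ d * v t

  -- The zero vector, which has no leading entry, is sent to the junk value (0, 0).
  normalize : ∀ {N} → Vect (suc N) → Fin (suc N) × Vect (suc N)
  normalize v with Fin.all? (λ t → v t ≟ 0#)
  ... | yes _  = fzero , v
  ... | no v≉0 = let (p , vp≉0 , _) = first-nonzero v v≉0 in p , λ t → inv (v p) vp≉0 * v t

  normalize-spec : ∀ {N} (v : Vect (suc N)) → ¬ (∀ t → v t ≈ 0#) → Normalizes v (normalize v)
  normalize-spec v v≉0 with Fin.all? (λ t → v t ≟ 0#)
  ... | yes v≈0 = ⊥-elim (v≉0 v≈0)
  ... | no v≉0′ = record
    { leading = *-inverseˡ (v p) vp≉0 , λ t t<p → trans (*-cong refl (v<p≈0 t t<p)) (zeroʳ w)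
    ; c       = v p
    ; v≈c*y   = λ t → sym (trans (sym (*-assoc _ w (v t)))
                                 (trans (*-cong (*-inverseʳ (v p) vp≉0) refl) (*-identityˡ (v t))))
    ; d       = w
    ; y≈d*v   = λ t → refl
    }
    where
    p = proj₁ (first-nonzero v v≉0′)
    vp≉0 = proj₁ (proj₂ (first-nonzero v v≉0′))
    v<p≈0 = proj₂ (proj₂ (first-nonzero v v≉0′))
    w = inv (v p) vp≉0

  Normalized : ∀ {N} → ℕ → Fin N × Vect N → Set
  Normalized A (p , y) = LeadingOne p y × A ℕ.≤ toℕ p

  _≈ₙ_ : ∀ {N} → Fin N × Vect N → Fin N × Vect N → Set
  (p , y) ≈ₙ (p′ , y′) = p ≡ p′ × y ≋ y′

  annihilate-one : ∀ {j m} (G : Fin (suc j) → Vect m) → LinIndep G → (f : Vect m) →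
                   Σ (Fin j → Vect m) λ X → LinIndep X × (∀ i → InSpan G (X i)) × (∀ i → dot f (X i) ≈ 0#)
  annihilate-one G G-indep f with Fin.any? (λ i → ¬? (dot f (G i) ≟ 0#))
  ... | no ∄ = tail G , indep-∘ {w = G} G-indep fsuc (λ _ _ → Fin.suc-injective) , generator∈span G ∘ fsuc ,
               λ i → decidable-stable (dot f (G (fsuc i)) ≟ 0#) (λ fGi≉0 → ∄ (fsuc i , fGi≉0))
  ... | yes (i₀ , fGi₀≉0) = shear i₀ κ G , shear-indep {G = G} G-indep i₀ κ , shear∈span i₀ κ G , killed
    where
    d = dot f (G i₀)
    κ : _ → Carrier
    κ i = - (dot f (G (punchIn i₀ i)) * inv d fGi₀≉0)
    killed : ∀ i → dot f (shear i₀ κ G i) ≈ 0#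
    killed i = begin
      dot f (shear i₀ κ G i)              ≈⟨ trans (dot-+ f _ _) (+-cong refl (dot-· f (κ i) (G i₀))) ⟩
      a + - (a * inv d fGi₀≉0) * d        ≈⟨ +-cong refl (-‿distribˡ-* _ d) ⟨
      a - a * inv d fGi₀≉0 * d            ≈⟨ +-cong refl (-‿cong (*-assoc a _ d)) ⟩
      a - a * (inv d fGi₀≉0 * d)          ≈⟨ +-cong refl (-‿cong (trans (*-cong refl (*-inverseˡ d fGi₀≉0)) (*-identityʳ a))) ⟩
      a - a                               ≈⟨ -‿inverseʳ a ⟩
      0#                                  ∎
      where
      a = dot f (G (punchIn i₀ i))

  homogeneous-solutions : ∀ {r} s j → j ℕ.+ s ℕ.≤ r → (fs : Fin s → Vect r) →
                          Σ (Fin j → Vect r) λ X → LinIndep X × (∀ s i → dot (fs s) (X i) ≈ 0#)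
  homogeneous-solutions {r} zero j j+0≤r fs =
    unit ∘ ι , indep-∘ {w = unit} units-indep ι (Fin.inject≤-injective _ _) , λ ()
    where
    ι : Fin j → Fin r
    ι i = Fin.inject≤ i (≡.subst (ℕ._≤ r) (ℕ.+-identityʳ j) j+0≤r)
  homogeneous-solutions {r} (suc s) j j+s+1≤r fs
    with homogeneous-solutions s (suc j) (≡.subst (ℕ._≤ r) (ℕ.+-suc j s) j+s+1≤r) (tail fs)
  ... | X₁ , X₁-indep , X₁-solves with annihilate-one X₁ X₁-indep (fs fzero)
  ...   | X , X-indep , X∈X₁ , X-solves = X , X-indep , solves
    where
    solves : ∀ s i → dot (fs s) (X i) ≈ 0#
    solves fzero    = X-solves
    solves (fsuc s) = span⊆subspace (kernel (fs (fsuc s))) (X₁-solves s) ∘ X∈X₁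

  solutions-vanishing-below : ∀ {m} a s → a ℕ.+ s ℕ.≤ m → (fs : Fin s → Vect m) →
    Σ (Fin (m ℕ.∸ a ℕ.∸ s) → Vect m) λ Y → LinIndep Y ×
      (∀ r → ZeroBelow a (Y r)) × (∀ j r → dot (fs j) (Y r) ≈ 0#)
  solutions-vanishing-below {m} a s a+s≤m fs = Y , Y-indep , Y-low , Y⊥fs
    where
    a≤m = ℕ.m+n≤o⇒m≤o a a+s≤m
    coordinates : Fin a → Vect m
    coordinates t = unit (Fin.inject≤ t a≤m)
    fits : m ℕ.∸ a ℕ.∸ s ℕ.+ (a ℕ.+ s) ≡ m
    fits = ≡.trans (≡.cong (ℕ._+ (a ℕ.+ s)) (ℕ.∸-+-assoc m a s)) (ℕ.m∸n+n≡m a+s≤m)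
    solution = homogeneous-solutions (a ℕ.+ s) _ (ℕ.≤-reflexive fits) (coordinates ++ fs)
    Y = proj₁ solution
    Y-indep = proj₁ (proj₂ solution)
    Y-low : ∀ r → ZeroBelow a (Y r)
    Y-low r t t<a = trans (sym (trans (dot-comm (unit t) (Y r)) (dot-unit (Y r) t)))
                          (≡.subst (λ e → dot e (Y r) ≈ 0#) equation≡unit
                                   (proj₂ (proj₂ solution) (Fin.fromℕ< t<a ↑ˡ s) r))
      where
      equation≡unit : (coordinates ++ fs) (Fin.fromℕ< t<a ↑ˡ s) ≡ unit t
      equation≡unit = ≡.trans (lookup-++ˡ coordinates fs (Fin.fromℕ< t<a))
                        (≡.cong unit (Fin.toℕ-injective (≡.trans (Fin.toℕ-inject≤ _ a≤m) (Fin.toℕ-fromℕ< t<a))))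
    Y⊥fs : ∀ j r → dot (fs j) (Y r) ≈ 0#
    Y⊥fs j r = ≡.subst (λ e → dot e (Y r) ≈ 0#) (lookup-++ʳ coordinates fs j)
                       (proj₂ (proj₂ solution) (a ↑ʳ j) r)

  +∈-cancelˡ : ∀ {m} (L : Subspace m) {u v : Vect m} → mem L u → mem L (u +v v) → mem L v
  +∈-cancelˡ L {u} {v} u∈L u+v∈L = resp L -u+[u+v]≋v (+∈ L (·∈ L (- 1#) u∈L) u+v∈L)
    where
    -u+[u+v]≋v : (((- 1#) ·v u) +v (u +v v)) ≋ v
    -u+[u+v]≋v t = begin
      - 1# * u t + (u t + v t)  ≈⟨ +-cong (-1*x≈-x (u t)) refl ⟩
      - u t + (u t + v t)       ≈⟨ +-assoc _ _ _ ⟨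
      - u t + u t + v t         ≈⟨ +-cong (-‿inverseˡ (u t)) refl ⟩
      0# + v t                  ≈⟨ +-identityˡ (v t) ⟩
      v t                       ∎

  +∈-cancelʳ : ∀ {m} (L : Subspace m) {u v : Vect m} → mem L v → mem L (u +v v) → mem L u
  +∈-cancelʳ L v∈L u+v∈L = +∈-cancelˡ L v∈L (resp L (λ t → +-comm _ _) u+v∈L)

  ·∈-cancel : ∀ {m} (L : Subspace m) {c} {u : Vect m} → ¬ c ≈ 0# → mem L (c ·v u) → mem L u
  ·∈-cancel L {c} {u} c≉0 cu∈L = resp L c⁻¹cu≋u (·∈ L (inv c c≉0) cu∈L)
    where
    c⁻¹cu≋u : (inv c c≉0 ·v (c ·v u)) ≋ u
    c⁻¹cu≋u t = trans (sym (*-assoc _ c (u t))) (trans (*-cong (*-inverseˡ c c≉0) refl) (*-identityˡ (u t)))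

  exchange-step : ∀ {k r m} (g : Fin (suc k) → Vect m) → LinIndep g → (h : Fin (suc r) → Vect m) →
                  InSpan (tail g ++ h) (g fzero) →
                  Σ (Fin (suc r)) λ j₀ → ∀ {x} → InSpan (tail g ++ h) x → InSpan (g ++ removeAt h j₀) x
  exchange-step {k} {r} g g-indep h (c , _ , g₀≋ch) =
    j₀ , span⊆subspace S (++-generators S (g∈S ∘ fsuc) h∈S)
    where
    μ = c ∘ (_↑ˡ suc r)
    ν = c ∘ (k ↑ʳ_)
    g₀≋μ+ν : g fzero ≋ (lincomb μ (tail g) +v lincomb ν h)
    g₀≋μ+ν = ≋-trans g₀≋ch (lincomb-++ c (tail g) h)
    ν≉0 : ∃ λ j → ¬ ν j ≈ 0#
    ν≉0 with Fin.any? (λ j → ¬? (ν j ≟ 0#))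
    ... | yes found = found
    ... | no ∄ = ⊥-elim (indep-head∉span-tail {g = g} g-indep μ g₀≋μ)
      where
      ν≈0 : ∀ j → ν j ≈ 0#
      ν≈0 j = decidable-stable (ν j ≟ 0#) (λ νj≉0 → ∄ (j , νj≉0))
      g₀≋μ : g fzero ≋ lincomb μ (tail g)
      g₀≋μ t = trans (g₀≋μ+ν t) (trans (+-cong refl (lincomb-zero h ν≈0 t)) (+-identityʳ _))
    j₀ = proj₁ ν≉0
    h′ = removeAt h j₀
    S = span (g ++ h′)
    g∈S : ∀ i → InSpan (g ++ h′) (g i)
    g∈S i = ≡.subst (InSpan (g ++ h′)) (lookup-++ˡ g h′ i) (generator∈span (g ++ h′) (i ↑ˡ r))
    h′∈S : ∀ j → InSpan (g ++ h′) (h′ j)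
    h′∈S j = ≡.subst (InSpan (g ++ h′)) (lookup-++ʳ g h′ j) (generator∈span (g ++ h′) (suc k ↑ʳ j))
    hj₀∈S : InSpan (g ++ h′) (h j₀)
    hj₀∈S = ·∈-cancel S (proj₂ ν≉0) (+∈-cancelʳ S (lincomb∈subspace S h′∈S (removeAt ν j₀))
              (+∈-cancelˡ S (lincomb∈subspace S (g∈S ∘ fsuc) μ)
                (resp S (≋-trans g₀≋μ+ν (λ t → +-cong refl (lincomb-removeAt j₀ ν h t))) (g∈S fzero))))
    h∈S : ∀ j → InSpan (g ++ h′) (h j)
    h∈S j with j₀ Fin.≟ j
    ... | yes ≡.refl = hj₀∈S
    ... | no j₀≢j    = ≡.subst (InSpan (g ++ h′) ∘ h) (Fin.punchIn-punchOut j₀≢j) (h′∈S (punchOut j₀≢j))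

  exchange : ∀ {m} k r {n} → k ℕ.+ r ≡ n → (u : Fin n → Vect m) (g : Fin k → Vect m) → LinIndep g →
             (∀ i → InSpan u (g i)) → Σ (Fin r → Vect m) λ h → ∀ i → InSpan (g ++ h) (u i)
  exchange zero r ≡.refl u g _ _ = u , generator∈span u
  exchange (suc k) r k+r≡n u g g-indep g∈u
    with exchange k (suc r) (≡.trans (ℕ.+-suc k r) k+r≡n) u (tail g)
                  (indep-∘ {w = g} g-indep fsuc (λ _ _ → Fin.suc-injective)) (g∈u ∘ fsuc)
  ... | h , u∈g′h with exchange-step g g-indep h (span⊆subspace (span (tail g ++ h)) u∈g′h (g∈u fzero))
  ...   | j₀ , g′h⊆gh′ = removeAt h j₀ , g′h⊆gh′ ∘ u∈g′h

  indep-spans : ∀ {n m} (u g : Fin n → Vect m) → LinIndep g → (∀ i → InSpan u (g i)) → ∀ i → InSpan g (u i)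
  indep-spans {n} u g g-indep g∈u i with exchange n 0 (ℕ.+-identityʳ n) u g g-indep g∈u
  ... | h , u∈g++h = span⊆subspace (span g) (++-generators (span g) (generator∈span g) (λ ())) (u∈g++h i)

  prefix-cong : ∀ {n m A} {w w′ : Fin n → Vect m} → (∀ i → w i ≋ w′ i) →
                ∀ {v} → InSpanPrefix w A v → InSpanPrefix w′ A v
  prefix-cong w≋w′ (c , c≥A≈0 , v≋cw) = c , c≥A≈0 , ≋-trans v≋cw (lincomb-cong (λ _ → refl) w≋w′)

  span-hasDim : ∀ {n m} {u : Fin n → Vect m} → LinIndep u → HasDim (span u) n
  span-hasDim {u = u} u-indep = u , generator∈span u , u-indep , λ _ v∈span → v∈span

  dimMeet-mono : ∀ {n₁ n₂ m} {L : Subspace m} {w : Fin n₁ → Vect m} {w′ : Fin n₂ → Vect m} {A A′ j} →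
                 (∀ {v} → InSpanPrefix w A v → InSpanPrefix w′ A′ v) →
                 DimMeetPrefixAtLeast L w A j → DimMeetPrefixAtLeast L w′ A′ j
  dimMeet-mono w⇒w′ (g , g∈ , g-indep) = g , (λ i → proj₁ (g∈ i) , w⇒w′ (proj₂ (g∈ i))) , g-indep

  dimMeet-prefix : ∀ {N m} (w : Fin N → Vect m) (L : Subspace m) {ℓ j} → j ℕ.≤ ℓ → ℓ ℕ.≤ N → HasDim L ℓ →
                   (∀ v → mem L v → InSpan w v) → DimMeetPrefixAtLeast L w (N ℕ.∸ (ℓ ℕ.∸ j)) j
  dimMeet-prefix {N} w L {ℓ} {j} j≤ℓ ℓ≤N (b , b∈L , b-indep , L⊆b) L⊆w =
    (λ r → lincomb (X r) b) , (λ r → lincomb∈subspace L b∈L (X r) , in-prefix r) , indep-lincomb X-indep b-indep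
    where
    s = ℓ ℕ.∸ j
    P = N ℕ.∸ s
    s≤N : s ℕ.≤ N
    s≤N = ℕ.≤-trans (ℕ.m∸n≤m ℓ j) ℓ≤N
    tail-index : Fin s → Fin N
    tail-index s′ = Fin.fromℕ< {P ℕ.+ toℕ s′}
      (≡.subst (P ℕ.+ toℕ s′ ℕ.<_) (ℕ.m∸n+n≡m s≤N) (ℕ.+-monoʳ-< P (Fin.toℕ<n s′)))
    C : Fin ℓ → Fin N → Carrier
    C i = proj₁ (L⊆w (b i) (b∈L i))
    b≋Cw : ∀ i → b i ≋ lincomb (C i) w
    b≋Cw i = proj₂ (proj₂ (L⊆w (b i) (b∈L i)))
    solutions = homogeneous-solutions s j (ℕ.≤-reflexive (ℕ.m+[n∸m]≡n j≤ℓ)) (λ s′ i → C i (tail-index s′))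
    X = proj₁ solutions
    X-indep = proj₁ (proj₂ solutions)
    X⊥ = proj₂ (proj₂ solutions)
    D : Fin j → Fin N → Carrier
    D r t = sum (λ i → X r i * C i t)
    in-prefix : ∀ r → InSpanPrefix w P (lincomb (X r) b)
    in-prefix r = D r , D≥P≈0 , ≋-trans (lincomb-cong (λ _ → refl) b≋Cw) (lincomb-assoc (X r) C w)
      where
      D≥P≈0 : ∀ t → P ℕ.≤ toℕ t → D r t ≈ 0#
      D≥P≈0 t P≤t = ≡.subst (λ t′ → D r t′ ≈ 0#) index≡t
                      (trans (dot-comm (X r) (λ i → C i (tail-index s′))) (X⊥ s′ r))
        where
        t-P<s : toℕ t ℕ.∸ P ℕ.< s
        t-P<s = ≡.subst (toℕ t ℕ.∸ P ℕ.<_) (ℕ.m∸[m∸n]≡n s≤N) (ℕ.∸-monoˡ-< (Fin.toℕ<n t) P≤t)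
        s′ = Fin.fromℕ< t-P<s
        index≡t : tail-index s′ ≡ t
        index≡t = Fin.toℕ-injective (≡.trans (Fin.toℕ-fromℕ< _)
                    (≡.trans (≡.cong (P ℕ.+_) (Fin.toℕ-fromℕ< t-P<s)) (ℕ.m+[n∸m]≡n P≤t)))

module Hyperplane (F : Field) (_≟_ : Decidable (Field._≈_ F)) {n : ℕ}
                  (B : Fin (suc n) → LinAlg.Vect F (suc n)) (B-basis : LinAlg.IsBasis F B) where
  open Field F
  open LinAlg F
  open Linear F _≟_
  open import Algebra.Properties.Ring ring using (-1*x≈-x; -‿distribˡ-*; -‿distribʳ-*; -‿involutive; -0#≈0#)
  open import Algebra.Properties.Group +-group using (inverseˡ-unique)
  open import Algebra.Properties.Semiring.Sum semiring using (sum; sum-cong-≋; sum-remove; *-distribˡ-sum)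
  open import Data.Vec.Functional.Relation.Binary.Equality.Setoid setoid using (≋-refl; ≋-sym; ≋-trans)
  open import Relation.Binary.Reasoning.Setoid setoid

  coord : Vect (suc n) → Vect (suc n)
  coord v = proj₁ (proj₂ B-basis v)

  coord-spec : ∀ v → v ≋ lincomb (coord v) B
  coord-spec v = proj₂ (proj₂ (proj₂ B-basis v))

  coord-unique : ∀ {v} c → v ≋ lincomb c B → coord v ≋ c
  coord-unique {v} c v≋cB = indep-unique {u = B} (proj₁ B-basis) (coord v) c (≋-trans (≋-sym (coord-spec v)) v≋cB)

  φ : Vect (suc n) → Vect (suc n) → Carrier
  φ y v = dot y (coord v)

  φ-cong : ∀ y {u v} → u ≋ v → φ y u ≈ φ y v
  φ-cong y {u} {v} u≋v = dot-congʳ y (coord-unique (coord v) (≋-trans u≋v (coord-spec v)))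

  φ-B : ∀ y t → φ y (B t) ≈ y t
  φ-B y t = trans (dot-congʳ y (coord-unique (unit t) (≋-sym (lincomb-unit t B)))) (dot-unit y t)

  φ-+ : ∀ y u v → φ y (u +v v) ≈ φ y u + φ y v
  φ-+ y u v = trans (dot-congʳ y coord-+) (dot-+ y (coord u) (coord v))
    where
    coord-+ : coord (u +v v) ≋ (coord u +v coord v)
    coord-+ = coord-unique _ (≋-trans (λ t → +-cong (coord-spec u t) (coord-spec v t))
                                      (≋-sym (lincomb-+ (coord u) (coord v) B)))

  φ-· : ∀ y c u → φ y (c ·v u) ≈ c * φ y u
  φ-· y c u = trans (dot-congʳ y coord-·) (dot-· y c (coord u))
    where
    coord-· : coord (c ·v u) ≋ (c ·v coord u)
    coord-· = coord-unique _ (≋-trans (λ t → *-cong refl (coord-spec u t)) (≋-sym (lincomb-* c (coord u) B)))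

  φ-scaleˡ : ∀ {y y₀} d → (∀ t → y t ≈ d * y₀ t) → ∀ v → φ y v ≈ d * φ y₀ v
  φ-scaleˡ d y≈dy₀ v = dot-scaleˡ d y≈dy₀ (coord v)

  hyperplane : Vect (suc n) → Subspace (suc n)
  hyperplane y = record
    { mem  = λ v → φ y v ≈ 0#
    ; resp = λ u≋v φu≈0 → trans (sym (φ-cong y u≋v)) φu≈0
    ; 0∈   = trans (φ-cong y (λ t → sym (zeroˡ (B fzero t)))) (trans (φ-· y 0# (B fzero)) (zeroˡ _))
    ; +∈   = λ φu≈0 φv≈0 → trans (φ-+ y _ _) (trans (+-cong φu≈0 φv≈0) (+-identityˡ 0#))
    ; ·∈   = λ c φu≈0 → trans (φ-· y c _) (trans (*-cong refl φu≈0) (zeroʳ c))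
    }

  κ : Fin (suc n) → Vect (suc n) → Fin n → Carrier
  κ p y i = - y (punchIn p i)

  prefix⊆hyperplane : ∀ {y A} → ZeroBelow A y → ∀ {v} → InSpanPrefix B A v → φ y v ≈ 0#
  prefix⊆hyperplane {y} {A} y<A≈0 (c , c≥A≈0 , v≋cB) = trans (dot-congʳ y (coord-unique c v≋cB)) (sum-zero term≈0)
    where
    term≈0 : ∀ t → y t * c t ≈ 0#
    term≈0 t with A ℕ.≤? toℕ t
    ... | yes A≤t = trans (*-cong refl (c≥A≈0 t A≤t)) (zeroʳ (y t))
    ... | no  A≰t = trans (*-cong (y<A≈0 t (ℕ.≰⇒> A≰t)) refl) (zeroˡ (c t))

  B₁ : Fin (suc n) → Vect (suc n) → Fin n → Vect (suc n)
  B₁ p y = shear p (κ p y) B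

  B₁-indep : ∀ p y → LinIndep (B₁ p y)
  B₁-indep p y = shear-indep {G = B} (proj₁ B-basis) p _

  B₁⊆hyperplane : ∀ p y → y p ≈ 1# → ∀ i → φ y (B₁ p y i) ≈ 0#
  B₁⊆hyperplane p y yp≈1 i = begin
    φ y (B₁ p y i)                                 ≈⟨ φ-+ y _ _ ⟩
    φ y (B (punchIn p i)) + φ y (a ·v B p)         ≈⟨ +-cong (φ-B y _) (trans (φ-· y a (B p)) (*-cong refl (φ-B y p))) ⟩
    y (punchIn p i) + a * y p                      ≈⟨ +-cong refl (trans (*-cong refl yp≈1) (*-identityʳ a)) ⟩
    y (punchIn p i) - y (punchIn p i)              ≈⟨ -‿inverseʳ _ ⟩
    0#                                             ∎
    where a = - y (punchIn p i)

  B₁-cong : ∀ p {y y′} → y ≋ y′ → ∀ i → B₁ p y i ≋ B₁ p y′ i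
  B₁-cong p y≋y′ i t = +-cong refl (*-cong (-‿cong (y≋y′ (punchIn p i))) refl)

  annihilates-B₁⇒multiple : ∀ p y′ y → y′ p ≈ 1# → (∀ i → φ y (B₁ p y′ i) ≈ 0#) → ∀ t → y t ≈ y p * y′ t
  annihilates-B₁⇒multiple p y′ y y′p≈1 y⊥B₁ t with p Fin.≟ t
  ... | yes ≡.refl = trans (sym (*-identityʳ (y p))) (*-cong refl (sym y′p≈1))
  ... | no  p≢t    = ≡.subst (λ s → y s ≈ y p * y′ s) (Fin.punchIn-punchOut p≢t) (at-punchIn (punchOut p≢t))
    where
    at-punchIn : ∀ i → y (punchIn p i) ≈ y p * y′ (punchIn p i)
    at-punchIn i = begin
      y (punchIn p i)                       ≈⟨ inverseˡ-unique _ _ sum≈0 ⟩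
      - (κ p y′ i * y p)                    ≈⟨ -‿cong (-‿distribˡ-* (y′ (punchIn p i)) (y p)) ⟨
      - - (y′ (punchIn p i) * y p)          ≈⟨ -‿involutive _ ⟩
      y′ (punchIn p i) * y p                ≈⟨ *-comm _ _ ⟩
      y p * y′ (punchIn p i)                ∎
      where
      sum≈0 : y (punchIn p i) + κ p y′ i * y p ≈ 0#
      sum≈0 = begin
        y (punchIn p i) + κ p y′ i * y p              ≈⟨ +-cong (φ-B y _) (trans (φ-· y _ (B p)) (*-cong refl (φ-B y p))) ⟨
        φ y (B (punchIn p i)) + φ y (κ p y′ i ·v B p) ≈⟨ φ-+ y _ _ ⟨
        φ y (B₁ p y′ i)                               ≈⟨ y⊥B₁ i ⟩
        0#                                            ∎

  hyperplane⊆span-B₁ : ∀ p y → y p ≈ 1# → ∀ {v} → φ y v ≈ 0# → InSpan (B₁ p y) v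
  hyperplane⊆span-B₁ p y yp≈1 {v} φv≈0 =
    spanned z (≋-trans (coord-spec v) (≋-sym (≋-trans (lincomb-shear p (κ p y) z B)
                                                      (lincomb-cong {u = B} (insertAt-removeAt-≈ c p S≈cp) (λ _ → ≋-refl)))))
    where
    c = coord v
    z = removeAt c p
    T = sum (λ i → y (punchIn p i) * z i)
    cp+T≈0 : c p + T ≈ 0#
    cp+T≈0 = begin
      c p + T                   ≈⟨ +-cong (trans (*-cong yp≈1 refl) (*-identityˡ (c p))) refl ⟨
      y p * c p + T             ≈⟨ sum-remove {i = p} (λ t → y t * c t) ⟨
      φ y v                     ≈⟨ φv≈0 ⟩
      0#                        ∎
    S≈cp : sum (λ i → z i * - y (punchIn p i)) ≈ c p
    S≈cp = begin
      sum (λ i → z i * - y (punchIn p i))          ≈⟨ sum-cong-≋ (λ i → x*-y≈-1*[y*x] (z i) (y (punchIn p i))) ⟩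
      sum (λ i → - 1# * (y (punchIn p i) * z i))   ≈⟨ *-distribˡ-sum (- 1#) (λ i → y (punchIn p i) * z i) ⟨
      - 1# * T                                     ≈⟨ -1*x≈-x T ⟩
      - T                                          ≈⟨ inverseˡ-unique (c p) T cp+T≈0 ⟨
      c p                                          ∎
      where
      x*-y≈-1*[y*x] : ∀ x y → x * - y ≈ - 1# * (y * x)
      x*-y≈-1*[y*x] x y = trans (sym (-‿distribʳ-* x y)) (trans (-‿cong (*-comm x y)) (sym (-1*x≈-x _)))

  -- The i-th vector of B₁ p y is B i for i < p, because y vanishes below p; so for A ≤ p the
  -- spans of the first A vectors of B₁ p y and of B agree.
  private
    shear-sum≈0 : ∀ {p : Fin (suc n)} {y : Vect (suc n)} {A} → A ℕ.≤ toℕ p → ZeroBelow (toℕ p) y →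
                  ∀ (z : Fin n → Carrier) → (∀ i → A ℕ.≤ toℕ i → z i ≈ 0#) →
                  sum (λ i → z i * - y (punchIn p i)) ≈ 0#
    shear-sum≈0 {p} {y} {A} A≤p y<p≈0 z z≥A≈0 = sum-zero term≈0
      where
      term≈0 : ∀ i → z i * - y (punchIn p i) ≈ 0#
      term≈0 i with A ℕ.≤? toℕ i
      ... | yes A≤i = trans (*-cong (z≥A≈0 i A≤i) refl) (zeroˡ _)
      ... | no  A≰i = trans (*-cong refl (trans (-‿cong (y<p≈0 _ pi<p)) -0#≈0#)) (zeroʳ _)
        where
        i<p : toℕ i ℕ.< toℕ p
        i<p = ℕ.<-≤-trans (ℕ.≰⇒> A≰i) A≤p
        pi<p = ≡.subst (ℕ._< toℕ p) (≡.sym (toℕ-punchIn-< p i i<p)) i<p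

  prefix-B₁⇒B : ∀ {p : Fin (suc n)} {y : Vect (suc n)} {A v} → A ℕ.≤ toℕ p → ZeroBelow (toℕ p) y →
                InSpanPrefix (B₁ p y) A v → InSpanPrefix B A v
  prefix-B₁⇒B {p} {y} {A} A≤p y<p≈0 (z , z≥A≈0 , v≋zB₁) =
    insertAt z p S , c≥A≈0 , ≋-trans v≋zB₁ (lincomb-shear p (κ p y) z B)
    where
    S = sum (λ i → z i * - y (punchIn p i))
    c≥A≈0 : ∀ t → A ℕ.≤ toℕ t → insertAt z p S t ≈ 0#
    c≥A≈0 t A≤t with p Fin.≟ t
    ... | yes ≡.refl = trans (reflexive (insertAt-lookup z p S)) (shear-sum≈0 A≤p y<p≈0 z z≥A≈0)
    ... | no p≢t = ≡.subst (λ s → insertAt z p S s ≈ 0#) (Fin.punchIn-punchOut p≢t)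
                     (trans (reflexive (insertAt-punchIn z p S i)) (z≥A≈0 i A≤i))
      where
      i = punchOut p≢t
      A≤i : A ℕ.≤ toℕ i
      A≤i = ℕ.≮⇒≥ λ i<A → ℕ.<⇒≱ (≡.subst (ℕ._< A) (i≡t i<A) i<A) A≤t
        where
        i≡t : toℕ i ℕ.< A → toℕ i ≡ toℕ t
        i≡t i<A = ≡.trans (≡.sym (toℕ-punchIn-< p i (ℕ.<-≤-trans i<A A≤p))) (≡.cong toℕ (Fin.punchIn-punchOut p≢t))

  prefix-B⇒B₁ : ∀ {p : Fin (suc n)} {y : Vect (suc n)} {A v} → A ℕ.≤ toℕ p → ZeroBelow (toℕ p) y →
                InSpanPrefix B A v → InSpanPrefix (B₁ p y) A v
  prefix-B⇒B₁ {p} {y} {A} A≤p y<p≈0 (c , c≥A≈0 , v≋cB) =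
    z , z≥A≈0 , ≋-trans v≋cB (≋-sym (≋-trans (lincomb-shear p (κ p y) z B)
                                             (lincomb-cong {u = B} (insertAt-removeAt-≈ c p S≈cp) (λ _ → ≋-refl))))
    where
    z = removeAt c p
    z≥A≈0 : ∀ i → A ℕ.≤ toℕ i → z i ≈ 0#
    z≥A≈0 i A≤i = c≥A≈0 _ (ℕ.≤-trans A≤i (toℕ≤toℕ-punchIn p i))
    S≈cp = trans (shear-sum≈0 A≤p y<p≈0 z z≥A≈0) (sym (c≥A≈0 p A≤p))

≈-decidable : ∀ F q → FieldOfSize F q → Decidable (Field._≈_ F)
≈-decidable F q (e , _ , e-inj , e-surj) x y with e-surj x tt | e-surj y tt
... | i , x≈ei | j , y≈ej with i Fin.≟ j
...   | yes ≡.refl = yes (Field.trans F x≈ei (Field.sym F y≈ej))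
...   | no  i≢j    = no λ x≈y → i≢j (e-inj i j (Field.trans F (Field.sym F x≈ei) (Field.trans F x≈y y≈ej)))

module Counting (F : Field) (q : ℕ) (F-size : FieldOfSize F q) where
  open Field F
  open LinAlg F
  open Linear F (≈-decidable F q F-size)

  ≈ₙ-trans : ∀ {N} {x y z : Fin N × Vect N} → x ≈ₙ y → y ≈ₙ z → x ≈ₙ z
  ≈ₙ-trans (≡.refl , y≋y′) (≡.refl , y′≋y″) = ≡.refl , λ t → trans (y≋y′ t) (y′≋y″ t)

  vectors-count : ∀ M → HasCard _≋_ (λ (_ : Vect M) → ⊤) (q ^ M)
  vectors-count zero = (λ _ ()) , (λ _ → tt) , (λ { fzero fzero _ → ≡.refl }) , λ _ _ → fzero , λ ()
  vectors-count (suc M) = f , (λ _ → tt) , f-inj , f-surj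
    where
    e = proj₁ F-size
    e-inj = proj₁ (proj₂ (proj₂ F-size))
    e-surj = proj₂ (proj₂ (proj₂ F-size))
    g = proj₁ (vectors-count M)
    g-inj = proj₁ (proj₂ (proj₂ (vectors-count M)))
    g-surj = proj₂ (proj₂ (proj₂ (vectors-count M)))
    f : Fin (q ^ suc M) → Vect (suc M)
    f x = let (i , j) = Fin.remQuot (q ^ M) x in e i ∷ g j
    f-inj : ∀ x x′ → f x ≋ f x′ → x ≡ x′
    f-inj x x′ fx≋fx′ = begin
      x                                          ≡⟨ Fin.combine-remQuot {q} (q ^ M) x ⟨
      Fin.combine (proj₁ (rq x)) (proj₂ (rq x))
        ≡⟨ ≡.cong₂ Fin.combine (e-inj _ _ (fx≋fx′ fzero)) (g-inj _ _ (fx≋fx′ ∘ fsuc)) ⟩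
      Fin.combine (proj₁ (rq x′)) (proj₂ (rq x′)) ≡⟨ Fin.combine-remQuot {q} (q ^ M) x′ ⟩
      x′                                         ∎
      where
      open ≡.≡-Reasoning
      rq = Fin.remQuot {q} (q ^ M)
    f-surj : ∀ v → ⊤ → ∃ λ x → v ≋ f x
    f-surj v _ with e-surj (v fzero) tt | g-surj (tail v) tt
    ... | i , v₀≈ei | j , v′≋gj =
      Fin.combine i j , ≡.subst (λ (i , j) → v ≋ (e i ∷ g j)) (≡.sym (Fin.remQuot-combine i j)) v≋
      where
      v≋ : v ≋ (e i ∷ g j)
      v≋ fzero    = v₀≈ei
      v≋ (fsuc t) = v′≋gj t

  shift : ∀ {N} → Fin N × Vect N → Fin (suc N) × Vect (suc N)
  shift (p , y) = fsuc p , 0# ∷ y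

  shift-count : ∀ {N A c} → HasCard _≈ₙ_ (Normalized {N} A) c → HasCard _≈ₙ_ (Normalized {suc N} (suc A)) c
  shift-count {N} {A} =
    HasCard-map {_≈A_ = _≈ₙ_} {_≈B_ = _≈ₙ_} {P = Normalized A} {Q = Normalized (suc A)}
                shift shift-normalized shift-inj unshift shift-resp ≈ₙ-trans
    where
    shift-normalized : ∀ {x} → Normalized A x → Normalized (suc A) (shift x)
    shift-normalized {p , y} ((yp≈1 , y<p≈0) , A≤p) =
      (yp≈1 , λ { fzero _ → refl ; (fsuc t) (s≤s t<p) → y<p≈0 t t<p }) , s≤s A≤p
    shift-inj : ∀ {x x′} → Normalized A x → Normalized A x′ → shift x ≈ₙ shift x′ → x ≈ₙ x′
    shift-inj {p , y} {p′ , y′} _ _ (sp≡sp′ , 0∷y≋0∷y′) = Fin.suc-injective sp≡sp′ , 0∷y≋0∷y′ ∘ fsuc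
    unshift : ∀ {z} → Normalized (suc A) z → ∃ λ x → Normalized A x × z ≈ₙ shift x
    unshift {fsuc p , y} ((yp≈1 , y<p≈0) , s≤s A≤p) =
      (p , tail y) , ((yp≈1 , λ t t<p → y<p≈0 (fsuc t) (s≤s t<p)) , A≤p) ,
      ≡.refl , λ { fzero → y<p≈0 fzero (s≤s z≤n) ; (fsuc t) → refl }
    shift-resp : ∀ {x x′} → Normalized A x′ → x ≈ₙ x′ → shift x ≈ₙ shift x′
    shift-resp _ (≡.refl , y≋y′) = ≡.refl , λ { fzero → refl ; (fsuc t) → y≋y′ t }

  PivotZero : ∀ {N} → Fin (suc N) × Vect (suc N) → Set
  PivotZero (p , y) = LeadingOne p y × p ≡ fzero

  pivot-zero-count : ∀ M → HasCard _≈ₙ_ (PivotZero {M}) (q ^ M)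
  pivot-zero-count M =
    HasCard-map {_≈A_ = _≋_} {_≈B_ = _≈ₙ_} {P = λ _ → ⊤} {Q = PivotZero}
                prepend-one prepend-pivot prepend-inj unprepend prepend-resp ≈ₙ-trans (vectors-count M)
    where
    prepend-one : Vect M → Fin (suc M) × Vect (suc M)
    prepend-one y = fzero , 1# ∷ y
    prepend-pivot : ∀ {y} → ⊤ → PivotZero (prepend-one y)
    prepend-pivot _ = (refl , λ _ ()) , ≡.refl
    prepend-inj : ∀ {y y′} → ⊤ → ⊤ → prepend-one y ≈ₙ prepend-one y′ → y ≋ y′
    prepend-inj _ _ (_ , 1∷y≋1∷y′) = 1∷y≋1∷y′ ∘ fsuc
    unprepend : ∀ {z} → PivotZero z → ∃ λ y → ⊤ × z ≈ₙ prepend-one y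
    unprepend {fzero , y} ((y₀≈1 , _) , _) = tail y , tt , ≡.refl , λ { fzero → y₀≈1 ; (fsuc t) → refl }
    prepend-resp : ∀ {y y′} → ⊤ → y ≋ y′ → prepend-one y ≈ₙ prepend-one y′
    prepend-resp _ y≋y′ = ≡.refl , λ { fzero → refl ; (fsuc t) → y≋y′ t }

  normalized-count : ∀ M A → HasCard _≈ₙ_ (Normalized {M} A) (geometric q (M ∸ A))
  normalized-count zero    zero    = (λ ()) , (λ ()) , (λ ()) , λ { (() , _) _ }
  normalized-count zero    (suc A) = (λ ()) , (λ ()) , (λ ()) , λ { (() , _) _ }
  normalized-count (suc M) (suc A) = shift-count (normalized-count M A)
  normalized-count (suc M) zero    =
    HasCard-⊎ {_≈_ = _≈ₙ_} {P = PivotZero} {Q = Normalized 1} (pivot-zero-count M) (shift-count (normalized-count M 0))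
              (λ { (≡.refl , _) (_ , ≡.refl) (_ , ()) }) (λ { (≡.refl , _) (_ , ()) (_ , ≡.refl) })
              split (λ (lead , _) → lead , z≤n) (λ (lead , _) → lead , z≤n)
    where
    split : ∀ {x} → Normalized 0 x → PivotZero x ⊎ Normalized 1 x
    split {fzero  , y} (lead , _) = inj₁ (lead , ≡.refl)
    split {fsuc p , y} (lead , _) = inj₂ (lead , s≤s z≤n)

alpha'-≤ : ∀ α k j → j ≤ k → alpha' α k j ≡ α j
alpha'-≤ α k j j≤k with j ℕ.≤ᵇ k | ℕ.≤⇒≤ᵇ j≤k
... | true  | _  = ≡.refl
... | false | ()

alpha'-> : ∀ α k j → k < j → alpha' α k j ≡ α j ∸ 1
alpha'-> α k j k<j with j ℕ.≤ᵇ k | ℕ.≤ᵇ⇒≤ j k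
... | true  | j≤k = ⊥-elim (ℕ.<⇒≱ k<j (j≤k _))
... | false | _   = ≡.refl

module Indices {ℓ n k : ℕ} {α : ℕ → ℕ} (α∈I : InI ℓ (suc n) α) (αℓ≡m : α ℓ ≡ suc n) (k-def : IsK ℓ α k) where
  open import Data.Nat using (_+_)
  open ℕ.≤-Reasoning

  α-step : ∀ j → 1 ≤ j → j < ℓ → α j < α (suc j)
  α-step = proj₁ (proj₂ α∈I)

  1≤k : 1 ≤ k
  1≤k = proj₁ (proj₁ k-def)

  k<ℓ : k < ℓ
  k<ℓ = proj₁ (proj₂ (proj₁ k-def))

  α-spread : ∀ i j → 1 ≤ i → i ≤ j → j ≤ ℓ → α i + (j ∸ i) ≤ α j
  α-spread i j 1≤i i≤j j≤ℓ with ℕ.m≤n⇒m<n∨m≡n i≤j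
  ... | inj₂ ≡.refl = ℕ.≤-reflexive (≡.trans (≡.cong (α i +_) (ℕ.n∸n≡0 i)) (ℕ.+-identityʳ (α i)))
  α-spread i (suc j) 1≤i _ j<ℓ | inj₁ (s≤s i≤j) = begin
    α i + (suc j ∸ i)     ≡⟨ ≡.cong (α i +_) (ℕ.+-∸-assoc 1 i≤j) ⟩
    α i + suc (j ∸ i)     ≡⟨ ℕ.+-suc (α i) (j ∸ i) ⟩
    suc (α i + (j ∸ i))   ≤⟨ s≤s (α-spread i j 1≤i i≤j (ℕ.<⇒≤ j<ℓ)) ⟩
    suc (α j)             ≤⟨ α-step j (ℕ.≤-trans 1≤i i≤j) j<ℓ ⟩
    α (suc j)             ∎

  j≤αj : ∀ j → 1 ≤ j → j ≤ ℓ → j ≤ α j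
  j≤αj j 1≤j j≤ℓ = begin
    j              ≡⟨ ℕ.m+[n∸m]≡n 1≤j ⟨
    1 + (j ∸ 1)    ≤⟨ ℕ.+-monoˡ-≤ (j ∸ 1) (proj₁ α∈I) ⟩
    α 1 + (j ∸ 1)  ≤⟨ α-spread 1 j ℕ.≤-refl 1≤j j≤ℓ ⟩
    α j            ∎

  αj≤αk : ∀ j → 1 ≤ j → j ≤ k → α j ≤ α k
  αj≤αk j 1≤j j≤k = ℕ.≤-trans (ℕ.m≤m+n (α j) (k ∸ j)) (α-spread j k 1≤j j≤k (ℕ.<⇒≤ k<ℓ))

  αk+[ℓ∸k]≤n : α k + (ℓ ∸ k) ≤ n
  αk+[ℓ∸k]≤n = ℕ.≤-pred (begin
    suc (α k + (ℓ ∸ k))              ≡⟨ ≡.cong (λ d → suc (α k + d)) (ℕ.+-∸-assoc 1 k<ℓ) ⟩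
    suc (α k + suc (ℓ ∸ suc k))      ≡⟨ ≡.cong suc (ℕ.+-suc (α k) (ℓ ∸ suc k)) ⟩
    2 + α k + (ℓ ∸ suc k)            ≤⟨ ℕ.+-monoˡ-≤ (ℓ ∸ suc k) (proj₂ (proj₂ (proj₁ k-def))) ⟩
    α (suc k) + (ℓ ∸ suc k)          ≤⟨ α-spread (suc k) ℓ (s≤s z≤n) k<ℓ ℕ.≤-refl ⟩
    α ℓ                              ≡⟨ αℓ≡m ⟩
    suc n                            ∎)

  α-consecutive : ∀ j → k < j → j < ℓ → α (suc j) ≡ suc (α j)
  α-consecutive j k<j j<ℓ with ℕ.m≤n⇒m<n∨m≡n (α-step j (ℕ.≤-trans 1≤k (ℕ.<⇒≤ k<j)) j<ℓ)
  ... | inj₂ αj<αj+1 = ≡.sym αj<αj+1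
  ... | inj₁ gap     = ⊥-elim (ℕ.<⇒≱ k<j (proj₂ k-def j (ℕ.≤-trans 1≤k (ℕ.<⇒≤ k<j)) j<ℓ gap))

  α-tail : ∀ d j → k < j → j + d ≡ ℓ → α j + d ≡ suc n
  α-tail zero    j _   j+0≡ℓ = ≡.trans (ℕ.+-identityʳ (α j))
                                (≡.trans (≡.cong α (≡.trans (≡.sym (ℕ.+-identityʳ j)) j+0≡ℓ)) αℓ≡m)
  α-tail (suc d) j k<j j+d+1≡ℓ = ≡.trans (ℕ.+-suc (α j) d)
    (≡.trans (≡.cong (_+ d) (≡.sym (α-consecutive j k<j j<ℓ)))
             (α-tail d (suc j) (ℕ.m<n⇒m<1+n k<j) (≡.trans (≡.sym (ℕ.+-suc j d)) j+d+1≡ℓ)))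
    where
    j<ℓ : j < ℓ
    j<ℓ = ≡.subst (j <_) j+d+1≡ℓ (ℕ.m<m+n j (s≤s z≤n))

  α′-tail : ∀ j → k < j → j ≤ ℓ → alpha' α k j ≡ n ∸ (ℓ ∸ j)
  α′-tail j k<j j≤ℓ = begin-equality
    alpha' α k j           ≡⟨ alpha'-> α k j k<j ⟩
    α j ∸ 1                ≡⟨ ≡.cong (_∸ 1) (ℕ.m+n∸n≡m (α j) s) ⟨
    α j + s ∸ s ∸ 1        ≡⟨ ≡.cong (λ x → x ∸ s ∸ 1) (α-tail s j k<j (ℕ.m+[n∸m]≡n j≤ℓ)) ⟩
    suc n ∸ s ∸ 1          ≡⟨ ℕ.∸-+-assoc (suc n) s 1 ⟩
    suc n ∸ (s + 1)        ≡⟨ ≡.cong (suc n ∸_) (ℕ.+-comm s 1) ⟩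
    n ∸ s                  ∎
    where s = ℓ ∸ j

module Cells (F : Field) (_≟_ : Decidable (Field._≈_ F)) {n : ℕ}
             (B : Fin (suc n) → LinAlg.Vect F (suc n)) (B-basis : LinAlg.IsBasis F B)
             {ℓ k : ℕ} {α : ℕ → ℕ} (α∈I : InI ℓ (suc n) α) (αℓ≡m : α ℓ ≡ suc n) (k-def : IsK ℓ α k)
             (1≤ℓ : 1 ≤ ℓ) (ℓ≤n : ℓ ≤ n) where
  open Field F hiding (_+_)
  open import Data.Nat using (_+_)
  open LinAlg F
  open Linear F _≟_
  open Hyperplane F _≟_ B B-basis
  open Indices α∈I αℓ≡m k-def
  open Schubert F
  open import Data.Vec.Functional.Relation.Binary.Equality.Setoid setoid using (≋-sym)

  α′ : ℕ → ℕ
  α′ = alpha' α k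

  a : ℕ
  a = α k

  -- Ω_{α′}(ℓ, W, B₁) for the hyperplane W = {v ∣ φ y v ≈ 0#} with its basis B₁ p y.
  cell : Fin (suc n) × Vect (suc n) → Family (suc n)
  cell (p , y) = Omega ℓ α′ (B₁ p y)

  LowConditions : ∀ {N} → (Fin N → Vect (suc n)) → Subspace (suc n) → Set
  LowConditions w L = ∀ j → 1 ≤ j → j ≤ k → DimMeetPrefixAtLeast L w (α j) j

  -- For j > k the condition of α′ holds for every ℓ-subspace of span w, as α′ j = n ∸ (ℓ ∸ j).
  Ω′-intro : ∀ (w : Fin n → Vect (suc n)) L → HasDim L ℓ → (∀ v → mem L v → InSpan w v) →
             LowConditions w L → Omega ℓ α′ w L
  Ω′-intro w L L-dim L⊆w low = L-dim , L⊆w , condition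
    where
    condition : ∀ j → 1 ≤ j → j ≤ ℓ → DimMeetPrefixAtLeast L w (α′ j) j
    condition j 1≤j j≤ℓ with j ℕ.≤? k
    ... | yes j≤k = ≡.subst (λ A → DimMeetPrefixAtLeast L w A j) (≡.sym (alpha'-≤ α k j j≤k)) (low j 1≤j j≤k)
    ... | no  j≰k = ≡.subst (λ A → DimMeetPrefixAtLeast L w A j) (≡.sym (α′-tail j (ℕ.≰⇒> j≰k) j≤ℓ))
                            (dimMeet-prefix w L j≤ℓ ℓ≤n L-dim L⊆w)

  Ω-low : ∀ {N β} (w : Fin N → Vect (suc n)) → (∀ j → j ≤ k → β j ≡ α j) →
          ∀ {L} → Omega ℓ β w L → LowConditions w L
  Ω-low w β≡α {L} (_ , _ , condition) j 1≤j j≤k =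
    ≡.subst (λ A → DimMeetPrefixAtLeast L w A j) (β≡α j j≤k) (condition j 1≤j (ℕ.≤-trans j≤k (ℕ.<⇒≤ k<ℓ)))

  Ω′-transfer : ∀ (w w′ : Fin n → Vect (suc n)) → (∀ {v} → InSpan w v → InSpan w′ v) →
                (∀ j → 1 ≤ j → j ≤ k → ∀ {v} → InSpanPrefix w (α j) v → InSpanPrefix w′ (α j) v) →
                ∀ L → Omega ℓ α′ w L → Omega ℓ α′ w′ L
  Ω′-transfer w w′ w⊆w′ prefix⊆ L L∈Ω@(L-dim , L⊆w , _) =
    Ω′-intro w′ L L-dim (λ v → w⊆w′ ∘ L⊆w v)
      λ j 1≤j j≤k → dimMeet-mono {L = L} (prefix⊆ j 1≤j j≤k) (Ω-low w (alpha'-≤ α k) {L} L∈Ω j 1≤j j≤k)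

  cell∈𝔖 : ∀ {x} → Normalized a x → InFrakS ℓ B α k (cell x)
  cell∈𝔖 {p , y} ((_ , y<p≈0) , a≤p) = B₁ p y , B₁-indep p y , (same-prefixes , Va⊆W) , λ _ → id , id
    where
    same-prefixes : ∀ i → 1 ≤ i → i ≤ k → ∀ v → InSpanPrefix (B₁ p y) (α i) v ⇔ InSpanPrefix B (α i) v
    same-prefixes i 1≤i i≤k v = prefix-B₁⇒B αi≤p y<p≈0 , prefix-B⇒B₁ αi≤p y<p≈0
      where αi≤p = ℕ.≤-trans (αj≤αk i 1≤i i≤k) a≤p
    Va⊆W : ∀ v → InSpanPrefix B a v → InSpan (B₁ p y) v
    Va⊆W v = prefix⇒span ∘ prefix-B⇒B₁ a≤p y<p≈0

  Ω′-member-containing : (w : Fin n → Vect (suc n)) → LinIndep w → ∀ i₀ → ∃ λ L → Omega ℓ α′ w L × mem L (w i₀)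
  Ω′-member-containing w w-indep i₀ with covering-subfamily 1≤ℓ ℓ≤n i₀
  ... | ι , ι-injective , hits-i₀ , hits-start =
    span (w ∘ ι) , Ω′-intro w (span (w ∘ ι)) (span-hasDim (indep-∘ {w = w} w-indep ι ι-injective)) L⊆w low ,
    w∈L hits-i₀
    where
    w∈L : ∀ {t} → ∃ (λ r → ι r ≡ t) → InSpan (w ∘ ι) (w t)
    w∈L (r , ≡.refl) = generator∈span (w ∘ ι) r
    L⊆w : ∀ v → InSpan (w ∘ ι) v → InSpan w v
    L⊆w _ = span⊆subspace (span w) (generator∈span w ∘ ι)
    low : LowConditions w (span (w ∘ ι))
    low j 1≤j j≤k =
      w ∘ first ,
      (λ r → w∈L (hits-start (first r) (first<pred r)) , generator∈prefix w (first r) (first<αj r)) ,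
      indep-∘ {w = w} w-indep first (Fin.inject≤-injective j≤n j≤n)
      where
      j≤ℓ = ℕ.≤-trans j≤k (ℕ.<⇒≤ k<ℓ)
      j≤n = ℕ.≤-trans j≤ℓ ℓ≤n
      first : Fin j → Fin n
      first r = Fin.inject≤ r j≤n
      first<j : ∀ r → toℕ (first r) < j
      first<j r = ≡.subst (_< j) (≡.sym (Fin.toℕ-inject≤ r j≤n)) (Fin.toℕ<n r)
      first<pred : ∀ r → toℕ (first r) < ℕ.pred ℓ
      first<pred r = ℕ.<-≤-trans (first<j r) (ℕ.≤-trans j≤k (ℕ.<⇒≤pred k<ℓ))
      first<αj : ∀ r → toℕ (first r) < α j
      first<αj r = ℕ.<-≤-trans (first<j r) (j≤αj j 1≤j j≤ℓ)

  cell-injective : ∀ {p y p′ y′} → LeadingOne p y → LeadingOne p′ y′ → cell (p , y) ≗F cell (p′ , y′) → p ≡ p′ × y ≋ y′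
  cell-injective {p} {y} {p′} {y′} lead@(yp≈1 , _) lead′@(y′p′≈1 , _) same =
    leadingOne-unique (y p′) lead lead′ (annihilates-B₁⇒multiple p′ y′ y y′p′≈1 y⊥B₁′)
    where
    y⊥B₁′ : ∀ i → φ y (B₁ p′ y′ i) ≈ 0#
    y⊥B₁′ i with Ω′-member-containing (B₁ p′ y′) (B₁-indep p′ y′) i
    ... | L , L∈cell′ , w∈L = span⊆subspace (hyperplane y) (B₁⊆hyperplane p y yp≈1)
                                (proj₁ (proj₂ (proj₂ (same L) L∈cell′)) _ w∈L)

  cell-surjective : ∀ {B₁′} → LinIndep B₁′ → StrictlyContained B α k B₁′ →
                    ∃ λ x → Normalized a x × (Omega ℓ α′ B₁′ ≗F cell x)
  cell-surjective {B₁′} B₁′-indep (same-prefix , Va⊆W) =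
    (p , y) , (lead , a≤p) ,
    λ L → Ω′-transfer B₁′ (B₁ p y) W⊆W₁ prefix⇒ L , Ω′-transfer (B₁ p y) B₁′ W₁⊆W prefix⇐ L
    where
    solution = homogeneous-solutions n 1 ℕ.≤-refl (coord ∘ B₁′)
    y₀ = proj₁ solution fzero
    y₀⊥W : ∀ i → φ y₀ (B₁′ i) ≈ 0#
    y₀⊥W i = trans (dot-comm y₀ (coord (B₁′ i))) (proj₂ (proj₂ solution) i fzero)
    module y₀ = Normalizes (normalize-spec y₀ (indep⇒nonzero {X = proj₁ solution} (proj₁ (proj₂ solution)) fzero))
    p = proj₁ (normalize y₀)
    y = proj₂ (normalize y₀)
    lead = y₀.leading
    W⊆H : ∀ {v} → InSpan B₁′ v → φ y v ≈ 0#
    W⊆H = span⊆subspace (hyperplane y)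
            (λ i → trans (φ-scaleˡ y₀.d y₀.y≈d*v (B₁′ i)) (trans (*-cong refl (y₀⊥W i)) (zeroʳ y₀.d)))
    a≤p : a ≤ toℕ p
    a≤p = ℕ.≮⇒≥ λ p<a →
      1≉0 (trans (sym (proj₁ lead)) (trans (sym (φ-B y p)) (W⊆H (Va⊆W (B p) (generator∈prefix B p p<a)))))
    W⊆W₁ : ∀ {v} → InSpan B₁′ v → InSpan (B₁ p y) v
    W⊆W₁ = hyperplane⊆span-B₁ p y (proj₁ lead) ∘ W⊆H
    W₁⊆W : ∀ {v} → InSpan (B₁ p y) v → InSpan B₁′ v
    W₁⊆W = span⊆subspace (span B₁′) (indep-spans (B₁ p y) B₁′ B₁′-indep (λ i → W⊆W₁ (generator∈span B₁′ i)))
    αj≤p : ∀ j → 1 ≤ j → j ≤ k → α j ≤ toℕ p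
    αj≤p j 1≤j j≤k = ℕ.≤-trans (αj≤αk j 1≤j j≤k) a≤p
    prefix⇒ : ∀ j → 1 ≤ j → j ≤ k → ∀ {v} → InSpanPrefix B₁′ (α j) v → InSpanPrefix (B₁ p y) (α j) v
    prefix⇒ j 1≤j j≤k v∈ = prefix-B⇒B₁ (αj≤p j 1≤j j≤k) (proj₂ lead) (proj₁ (same-prefix j 1≤j j≤k _) v∈)
    prefix⇐ : ∀ j → 1 ≤ j → j ≤ k → ∀ {v} → InSpanPrefix (B₁ p y) (α j) v → InSpanPrefix B₁′ (α j) v
    prefix⇐ j 1≤j j≤k v∈ = proj₂ (same-prefix j 1≤j j≤k _) (prefix-B₁⇒B (αj≤p j 1≤j j≤k) (proj₂ lead) v∈)

  ≗F-trans : ∀ {P Q R : Family (suc n)} → P ≗F Q → Q ≗F R → P ≗F R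
  ≗F-trans P≗Q Q≗R L = proj₁ (Q≗R L) ∘ proj₁ (P≗Q L) , proj₂ (P≗Q L) ∘ proj₂ (Q≗R L)

  cell-resp : ∀ {x x′ : Fin (suc n) × Vect (suc n)} → x ≈ₙ x′ → cell x ≗F cell x′
  cell-resp {p , y} {_ , y′} (≡.refl , y≋y′) L =
    Ω′-transfer _ _ (prefix-cong (B₁-cong p y≋y′)) (λ _ _ _ → prefix-cong (B₁-cong p y≋y′)) L ,
    Ω′-transfer _ _ (prefix-cong (B₁-cong p y′≋y)) (λ _ _ _ → prefix-cong (B₁-cong p y′≋y)) L
    where y′≋y = ≋-sym y≋y′

  member-is-cell : ∀ {Ω} → InFrakS ℓ B α k Ω → ∃ λ x → Normalized a x × Ω ≗F cell x
  member-is-cell {Ω} (B₁′ , B₁′-indep , strict , Ω≗) =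
    proj₁ found , proj₁ (proj₂ found) ,
    ≗F-trans {P = Ω} {Q = Omega ℓ α′ B₁′} {R = cell (proj₁ found)} Ω≗ (proj₂ (proj₂ found))
    where found = cell-surjective B₁′-indep strict

  𝔖-count : ∀ {c} → HasCard _≈ₙ_ (Normalized {suc n} a) c → HasCard _≗F_ (InFrakS ℓ B α k) c
  𝔖-count = HasCard-map {_≈A_ = _≈ₙ_} {_≈B_ = _≗F_} {P = Normalized a} {Q = InFrakS ℓ B α k}
                        cell cell∈𝔖 (λ nx nx′ → cell-injective (proj₁ nx) (proj₁ nx′))
                        member-is-cell (λ _ → cell-resp) ≗F-trans

  s₂ r₂ : ℕ
  s₂ = ℓ ∸ k
  r₂ = (suc n ∸ a) ∸ s₂

  -- Extending k independent vectors of L ∩ Vₐ to a spanning family of L adds only s₂ = ℓ ∸ k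
  -- vectors h, so every functional vanishing on Vₐ and on h vanishes on L.
  L+Vₐ-annihilator : ∀ {L} → Omega ℓ α B L →
                Σ (Fin r₂ → Vect (suc n)) λ Y → LinIndep Y ×
                  ∀ z → ZeroBelow a (lincomb z Y) × (∀ {v} → mem L v → φ (lincomb z Y) v ≈ 0#)
  L+Vₐ-annihilator {L} ((b , _ , _ , L⊆b) , _ , condition) = Y , Y-indep , λ z → y-low z , L⊥y z
    where
    meet = condition k 1≤k (ℕ.<⇒≤ k<ℓ)
    g = proj₁ meet
    g∈ = proj₁ (proj₂ meet)
    extension = exchange k s₂ (ℕ.m+[n∸m]≡n (ℕ.<⇒≤ k<ℓ)) b g (proj₂ (proj₂ meet)) (λ i → L⊆b (g i) (proj₁ (g∈ i)))
    h = proj₁ extension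
    solution = solutions-vanishing-below a s₂ (ℕ.m≤n⇒m≤1+n αk+[ℓ∸k]≤n) (coord ∘ h)
    Y = proj₁ solution
    Y-indep = proj₁ (proj₂ solution)
    Y-low = proj₁ (proj₂ (proj₂ solution))
    y-low : ∀ z → ZeroBelow a (lincomb z Y)
    y-low z t t<a = trans (reflexive (lincomb-pointwise z Y t))
                          (sum-zero λ r → trans (*-cong refl (Y-low r t t<a)) (zeroʳ _))
    L⊥y : ∀ z {v} → mem L v → φ (lincomb z Y) v ≈ 0#
    L⊥y z v∈L = span⊆subspace H (λ i → span⊆subspace H (++-generators H g⊥ h⊥) (proj₂ extension i)) (L⊆b _ v∈L)
      where
      H = hyperplane (lincomb z Y)
      g⊥ : ∀ i → φ (lincomb z Y) (g i) ≈ 0#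
      g⊥ i = prefix⊆hyperplane (y-low z) (proj₂ (g∈ i))
      h⊥ : ∀ j → φ (lincomb z Y) (h j) ≈ 0#
      h⊥ j = trans (dot-comm (lincomb z Y) (coord (h j)))
                   (lincomb∈subspace (kernel (coord (h j))) (proj₂ (proj₂ (proj₂ solution)) j) z)

  cell-containing : ∀ {L} → Omega ℓ α B L → ∀ {y p y′} d → LeadingOne p y′ → (∀ t → y′ t ≈ d * y t) →
                 ZeroBelow a y → (∀ {v} → mem L v → φ y v ≈ 0#) →
                 Normalized a (p , y′) × cell (p , y′) L
  cell-containing {L} L∈Ω {y} {p} {y′} d lead y′≈dy y<a≈0 L⊥y =
    (lead , a≤p) , Ω′-intro (B₁ p y′) L (proj₁ L∈Ω) L⊆W low
    where
    a≤p : a ≤ toℕ p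
    a≤p = ℕ.≮⇒≥ λ p<a →
      1≉0 (trans (sym (proj₁ lead)) (trans (y′≈dy p) (trans (*-cong refl (y<a≈0 p p<a)) (zeroʳ d))))
    L⊆W : ∀ v → mem L v → InSpan (B₁ p y′) v
    L⊆W v v∈L = hyperplane⊆span-B₁ p y′ (proj₁ lead)
                  (trans (φ-scaleˡ d y′≈dy v) (trans (*-cong refl (L⊥y v∈L)) (zeroʳ d)))
    low : LowConditions (B₁ p y′) L
    low j 1≤j j≤k =
      dimMeet-mono {L = L} {w = B} (prefix-B⇒B₁ {p = p} {y = y′} (ℕ.≤-trans (αj≤αk j 1≤j j≤k) a≤p) (proj₂ lead))
                   (Ω-low B (λ _ _ → ≡.refl) {L} L∈Ω j 1≤j j≤k)

  𝔖-containing-count : ∀ {L} → Omega ℓ α B L → ∀ {c} → HasCard _≈ₙ_ (Normalized {r₂} 0) c →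
                    AtLeast _≗F_ (λ Ω → InFrakS ℓ B α k Ω × Ω L) c
  𝔖-containing-count {L} L∈Ω =
    AtLeast-map {_≈A_ = _≈ₙ_} {_≈B_ = _≗F_} {P = Normalized 0} {Q = λ Ω → InFrakS ℓ B α k Ω × Ω L}
                (cell ∘ hyperplaneOf) family-ok family-inj
    where
    Y = proj₁ (L+Vₐ-annihilator {L} L∈Ω)
    Y-indep = proj₁ (proj₂ (L+Vₐ-annihilator {L} L∈Ω))
    L⊥zY = proj₂ (proj₂ (L+Vₐ-annihilator {L} L∈Ω))
    hyperplaneOf : Fin r₂ × Vect r₂ → Fin (suc n) × Vect (suc n)
    hyperplaneOf (_ , z) = normalize (lincomb z Y)
    spec : ∀ {x} → Normalized 0 x → Normalizes (lincomb (proj₂ x) Y) (hyperplaneOf x)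
    spec {p , z} ((zp≈1 , _) , _) = normalize-spec (lincomb z Y) λ zY≈0 → 1≉0 (trans (sym zp≈1) (Y-indep z zY≈0 p))
    family-ok : ∀ {x} → Normalized 0 x → InFrakS ℓ B α k (cell (hyperplaneOf x)) × cell (hyperplaneOf x) L
    family-ok {p , z} nx = cell∈𝔖 (proj₁ containing) , proj₂ containing
      where
      module y = Normalizes (spec nx)
      containing = cell-containing {L} L∈Ω y.d y.leading y.y≈d*v (proj₁ (L⊥zY z)) (proj₂ (L⊥zY z))
    family-inj : ∀ {x x′} → Normalized 0 x → Normalized 0 x′ → cell (hyperplaneOf x) ≗F cell (hyperplaneOf x′) → x ≈ₙ x′
    family-inj {p , z} {p′ , z′} nx nx′ same = leadingOne-unique (y.c * y′.d) (proj₁ nx) (proj₁ nx′) z≈cz′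
      where
      module y = Normalizes (spec nx)
      module y′ = Normalizes (spec nx′)
      ŷ≋ŷ′ = proj₂ (cell-injective y.leading y′.leading same)
      zY≋czY′ : lincomb z Y ≋ lincomb (λ r → (y.c * y′.d) * z′ r) Y
      zY≋czY′ t = begin
        lincomb z Y t                          ≈⟨ y.v≈c*y t ⟩
        y.c * proj₂ (hyperplaneOf (p , z)) t   ≈⟨ *-cong refl (ŷ≋ŷ′ t) ⟩
        y.c * proj₂ (hyperplaneOf (p′ , z′)) t ≈⟨ *-cong refl (y′.y≈d*v t) ⟩
        y.c * (y′.d * lincomb z′ Y t)          ≈⟨ *-assoc y.c y′.d _ ⟨
        y.c * y′.d * lincomb z′ Y t            ≈⟨ lincomb-* (y.c * y′.d) z′ Y t ⟨
        lincomb (λ r → (y.c * y′.d) * z′ r) Y t ∎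
        where open import Relation.Binary.Reasoning.Setoid setoid
      z≈cz′ : ∀ r → z r ≈ (y.c * y′.d) * z′ r
      z≈cz′ = indep-unique {u = Y} Y-indep z _ zY≋czY′

proposition4p3 : (q : ℕ) → IsPrimePower q → .{{_ : NonZero (q ∸ 1)}} →
    (F : Field) → FieldOfSize F q →
    (ℓ m : ℕ) → 1 ≤ ℓ → ℓ ≤ m ∸ 1 →
    (B : Fin m → LinAlg.Vect F m) → LinAlg.IsBasis F B →
    (α : ℕ → ℕ) → InI ℓ m α → α ℓ ≡ m → ¬ Consecutive ℓ α →
    (k : ℕ) → IsK ℓ α k →
    HasCard (LinAlg._≗F_ F) (Schubert.InFrakS F ℓ B α k)
      ((q ^ (m ∸ α k) ∸ 1) / (q ∸ 1))
    ×
    (∀ (L : LinAlg.Subspace F m) → LinAlg.Omega F ℓ α B L →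
      AtLeast (LinAlg._≗F_ F) (λ Ω → Schubert.InFrakS F ℓ B α k Ω × Ω L)
        ((q ^ ((m ∸ α k) ∸ (ℓ ∸ k)) ∸ 1) / (q ∸ 1)))
proposition4p3 zero _ F (_ , _ , _ , onto) = ⊥-elim (Fin.¬Fin0 (proj₁ (onto (Field.0# F) tt)))
proposition4p3 (suc q′) _ F F-size ℓ zero 1≤ℓ ℓ≤0 = ⊥-elim (ℕ.<⇒≱ 1≤ℓ ℓ≤0)
proposition4p3 (suc q′) _ F F-size ℓ (suc n) 1≤ℓ ℓ≤n B B-basis α α∈I αℓ≡m _ k k-def =
  ≡.subst (HasCard (LinAlg._≗F_ F) (Schubert.InFrakS F ℓ B α k)) (≡.sym (geometric-closed q′ (suc n ∸ α k)))
          (𝔖-count (normalized-count (suc n) (α k))) ,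
  λ L L∈Ω → ≡.subst (AtLeast (LinAlg._≗F_ F) (λ Ω → Schubert.InFrakS F ℓ B α k Ω × Ω L))
                    (≡.sym (geometric-closed q′ r₂)) (𝔖-containing-count {L} L∈Ω (normalized-count r₂ 0))
  where
  open Counting F (suc q′) F-size
  open Cells F (≈-decidable F (suc q′) F-size) B B-basis α∈I αℓ≡m k-def 1≤ℓ ℓ≤n
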